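{- Let $D$ be an $\mathrm{STS}_2(v)$ on $V=\mathbb{F}_2^v$ which is invariant under $\langle A_{v,f}\rangle$, where $f\in\{0,\ldots,v-1\}$ with $v-f$ even. Let $F_7$ and $F_1$ denote the sets of blocks of $D$ which are fixed planes of type $7$ and of type $1$, respectively. Then \[ \#F_7=\frac{(2^f-1)(2^{f-1}-1)}{21},\qquad \#F_1=\#\{\text{orbit lines}\}=\frac{2^{v-f}-1}{3}. \]
   Context: An $\mathrm{STS}_2(v)$ on $V=\mathbb{F}_2^v$ is a set of $3$-dimensional subspaces (blocks) of $V$ such that every $2$-dimensional subspace lies in exactly one block. $A_{v,f}$ is the block-diagonal matrix over $\mathbb{F}_2$ consisting of $\frac{v-f}{2}$ blocks $\begin{pmatrix}0&1\\1&1\end{pmatrix}$ followed by $I_f$, acting on subspaces via $\mathbf{x}\mapsto\mathbf{x}A_{v,f}$. Point orbits of size $3$ whose three points are collinear are called orbit lines. A fixed plane is of type $7$ if all its $7$ points are fixed, and of type $1$ otherwise (then the action restricted to it has order $3$). -}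

module Defs where

open import Data.Bool using (Bool; true; false; _∧_; _∨_; not; _xor_; if_then_else_)
open import Data.Nat using (ℕ; zero; suc; _+_; _*_; _∸_; _^_; _≤_; _<_; _<ᵇ_; _≡ᵇ_; _≤ᵇ_)
open import Data.Nat.DivMod using (_/_; _%_)
open import Data.Fin using (Fin; toℕ)
open import Data.Vec using (Vec; []; _∷_; lookup; tabulate; replicate; zipWith; toList)
open import Data.List using (List; []; _∷_; _++_; map; filter; length; foldr)
open import Data.Bool.ListAction using (all; any)
open import Data.List.Membership.Propositional using (_∈_)
open import Data.List.Relation.Unary.All using (All)
open import Data.Product using (Σ; _×_; _,_)
open import Relation.Binary.PropositionalEquality using (_≡_)
open import Relation.Nullary.Decidable using (Dec)
open import Data.Bool using (T)
open import Relation.Nullary using (yes; no)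
open import Data.Bool.Properties using (T?)

-- Vectors of F₂^v are row vectors  Vec Bool v  (true = 1, addition = xor).
Vect : ℕ → Set
Vect v = Vec Bool v

zeroV : (v : ℕ) → Vect v
zeroV v = replicate v false

_⊕_ : {v : ℕ} → Vect v → Vect v → Vect v
x ⊕ y = zipWith _xor_ x y

_==_ : {v : ℕ} → Vect v → Vect v → Bool
[] == [] = true
(a ∷ x) == (b ∷ y) = not (a xor b) ∧ (x == y)

allVecs : (v : ℕ) → List (Vect v)
allVecs zero = [] ∷ []
allVecs (suc v) = map (false ∷_) (allVecs v) ++ map (true ∷_) (allVecs v)

-- nonzero vectors = points of PG(v-1,2)
isPoint : {v : ℕ} → Vect v → Bool
isPoint {v} x = not (x == zeroV v)

VSet : ℕ → Set
VSet v = Vect v → Bool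

card : {v : ℕ} → VSet v → ℕ
card {v} S = length (filter (λ x → T? (S x)) (allVecs v))

IsSubspace : (v k : ℕ) → VSet v → Set
IsSubspace v k S =
  (S (zeroV v) ≡ true) ×
  ((x y : Vect v) → S x ≡ true → S y ≡ true → S (x ⊕ y) ≡ true) ×
  (card S ≡ 2 ^ k)

_⊆ᵇ_ : {v : ℕ} → VSet v → VSet v → Bool
_⊆ᵇ_ {v} L B = all (λ x → not (L x) ∨ B x) (allVecs v)

countContaining : {v : ℕ} → List (VSet v) → VSet v → ℕ
countContaining D L = length (filter (λ B → T? (L ⊆ᵇ B)) D)

IsSTS2 : (v : ℕ) → List (VSet v) → Set
IsSTS2 v D =
  All (IsSubspace v 3) D ×
  ((L : VSet v) → IsSubspace v 2 L → countContaining D L ≡ 1)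

-- Matrices over F₂ as functions  Fin v → Fin v → Bool  (row, column).
Mat : ℕ → Set
Mat v = Fin v → Fin v → Bool

-- A_{v,f}: (v-f)/2 diagonal blocks [[0,1],[1,1]] followed by I_f.
A : (v f : ℕ) → Mat v
A v f i j =
  let m = v ∸ f ; a = toℕ i ; b = toℕ j in
  if (a <ᵇ m) ∧ (b <ᵇ m)
  then ((a / 2) ≡ᵇ (b / 2)) ∧ not ((a % 2 ≡ᵇ 0) ∧ (b % 2 ≡ᵇ 0))
  else (if (m ≤ᵇ a) ∧ (m ≤ᵇ b) then a ≡ᵇ b else false)

_·_ : {v : ℕ} → Vect v → Mat v → Vect v
_·_ {v} x M = tabulate (λ j → foldr _xor_ false (toList (tabulate (λ i → lookup x i ∧ M i j))))

image : {v : ℕ} → Mat v → VSet v → VSet v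
image {v} M S y = any (λ x → S x ∧ ((x · M) == y)) (allVecs v)

Invariant : {v : ℕ} → Mat v → List (VSet v) → Set
Invariant M D = (B : _) → B ∈ D → Σ _ (λ B' → (B' ∈ D) × ((y : _) → B' y ≡ image M B y))

isFixedᵇ : {v : ℕ} → Mat v → VSet v → Bool
isFixedᵇ {v} M B = all (λ y → not (image M B y xor B y)) (allVecs v)

allPointsFixedᵇ : {v : ℕ} → Mat v → VSet v → Bool
allPointsFixedᵇ {v} M B = all (λ x → not (B x) ∨ ((x · M) == x)) (allVecs v)

isType7ᵇ : {v : ℕ} → Mat v → VSet v → Bool
isType7ᵇ M B = isFixedᵇ M B ∧ allPointsFixedᵇ M B

isType1ᵇ : {v : ℕ} → Mat v → VSet v → Bool
isType1ᵇ M B = isFixedᵇ M B ∧ not (allPointsFixedᵇ M B)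

#F7 : {v : ℕ} → Mat v → List (VSet v) → ℕ
#F7 M D = length (filter (λ B → T? (isType7ᵇ M B)) D)

#F1 : {v : ℕ} → Mat v → List (VSet v) → ℕ
#F1 M D = length (filter (λ B → T? (isType1ᵇ M B)) D)

-- Orbit lines.  x is a point whose orbit {x, xM, xM²} has size 3
-- and whose three points are collinear (x + xM + xM² = 0).
onOrbitLineᵇ : {v : ℕ} → Mat v → Vect v → Bool
onOrbitLineᵇ {v} M x =
  let x1 = x · M ; x2 = x1 · M ; x3 = x2 · M in
  isPoint x ∧ not (x1 == x) ∧ not (x2 == x) ∧ (x3 == x)
  ∧ ((x ⊕ (x1 ⊕ x2)) == zeroV v)

val : {v : ℕ} → Vect v → ℕ
val [] = 0
val (b ∷ x) = (if b then 1 else 0) + 2 * val x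

-- each orbit line is counted once, via its point of least binary value
isOrbitRepᵇ : {v : ℕ} → Mat v → Vect v → Bool
isOrbitRepᵇ M x =
  let x1 = x · M ; x2 = x1 · M in
  onOrbitLineᵇ M x ∧ (val x ≤ᵇ val x1) ∧ (val x ≤ᵇ val x2)

#orbitLines : {v : ℕ} → Mat v → ℕ
#orbitLines {v} M = length (filter (λ x → T? (isOrbitRepᵇ M x)) (allVecs v))

-- Write P x = x A.  Any matrix with A³ = I splits off two subspaces: the
-- fixed space F = {x | P x = x} and W = ker (1 + P + P²), with F ∩ W = 0;
-- P permutes W ∖ 0 in orbits {w, P w, P² w}, which are the orbit lines.
-- For such a P (module OrderThree) a P-closed plane through two distinct
-- nonzero fixed points is fixed pointwise, since otherwise it would contain
-- the 16 distinct sums of ⟨x, y⟩ ⊆ F and ⟨w, P w⟩ ⊆ W; and a P-closed plane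
-- through w ∈ W ∖ 0 meets W only in ⟨w, P w⟩.  In an invariant STS (module
-- InvariantSTS) a block through a P-invariant line is fixed, so double
-- counting gives 42 #F7 = |F ∖ 0| (|F ∖ 0| - 1), each line through two fixed
-- points lying in one block, of type 7, and 3 #F1 = |W ∖ 0|, each orbit
-- line lying in one block, of type 1, which contains no other orbit point.

module Submission where

open import Defs
open import Data.Bool using (Bool; true; false; _∧_; _∨_; not; _xor_; T)
import Data.Bool.Properties as BP
open import Data.Bool.Properties using (T?)
open import Data.Bool.ListAction using (all; any)
open import Data.Nat using (ℕ; zero; suc; _+_; _*_; _∸_; _^_; _≤_; _<_; _≤ᵇ_; _<ᵇ_; _≡ᵇ_; z≤n; s≤s)
import Data.Nat.Properties as NP
open import Data.Nat.Divisibility using (_∣_; divides)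
open import Data.Nat.DivMod using (_/_; _%_; m*n/n≡m; m*n%n≡0; [m+kn]%n≡m%n; m/n≡1+[m∸n]/n; m≡m%n+[m/n]*n; m%n<n; m<n*o⇒m/o<n)
open import Data.Fin as F using (Fin; toℕ)
import Data.Fin.Properties as FP
open import Data.Vec as V using (Vec; []; _∷_; lookup; tabulate)
import Data.Vec.Properties as VP
open import Data.List as L using (List; []; _∷_; _++_; map; filter; length; cartesianProductWith)
open import Data.List.Membership.Propositional using (_∈_)
import Data.List.Membership.Propositional.Properties as MP
import Data.List.Membership.DecPropositional as DecMem
open import Data.List.Relation.Unary.Any using (here; there)
open import Data.List.Relation.Unary.All as All using (All; []; _∷_)
import Data.List.Relation.Unary.All.Properties as AllP
open import Data.List.Relation.Unary.AllPairs using ([]; _∷_)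
open import Data.List.Relation.Unary.Unique.Propositional using (Unique)
import Data.List.Relation.Unary.Unique.Propositional.Properties as UniqueP
open import Data.Product using (Σ; _,_; proj₁; proj₂; _×_)
open import Data.Sum using (_⊎_; inj₁; inj₂)
open import Data.Empty using (⊥; ⊥-elim)
open import Function using (_∘_)
open import Relation.Nullary using (¬_; yes; no)
open import Relation.Nullary.Decidable using (from-no)
open import Relation.Binary using (DecidableEquality; tri<; tri≈; tri>)
open import Relation.Binary.PropositionalEquality using (_≡_; _≢_; refl; sym; trans; cong; cong₂; subst; module ≡-Reasoning)
open import Algebra.Bundles using (CommutativeRing)
open import Algebra.Properties.CommutativeSemigroup NP.+-commutativeSemigroup
  using () renaming (interchange to +-interchange)
open import Algebra.Properties.CommutativeSemigroup (CommutativeRing.+-commutativeSemigroup BP.xor-∧-commutativeRing)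
  using () renaming (interchange to xor-interchange)

∧-true-l : ∀ {a b} → a ∧ b ≡ true → a ≡ true
∧-true-l {true} _ = refl

∧-true-r : ∀ {a b} → a ∧ b ≡ true → b ≡ true
∧-true-r {true} p = p

∧-true : ∀ {a b} → a ≡ true → b ≡ true → a ∧ b ≡ true
∧-true refl refl = refl

bool-iff : ∀ {a b : Bool} → (a ≡ true → b ≡ true) → (b ≡ true → a ≡ true) → a ≡ b
bool-iff {true} {true} _ _ = refl
bool-iff {false} {false} _ _ = refl
bool-iff {true} {false} f _ = sym (f refl)
bool-iff {false} {true} _ g = g refl

bool-contradiction : ∀ {a} → a ≡ true → a ≡ false → ⊥
bool-contradiction refl ()

≢true : ∀ {a} → a ≢ true → a ≡ false
≢true = BP.¬-not

xnor-refl : ∀ b → not (b xor b) ≡ true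
xnor-refl true = refl
xnor-refl false = refl

xnor-sound : ∀ {a b} → not (a xor b) ≡ true → a ≡ b
xnor-sound {true} {true} _ = refl
xnor-sound {false} {false} _ = refl

==-refl : ∀ {v} (x : Vect v) → (x == x) ≡ true
==-refl [] = refl
==-refl (true ∷ x) = ==-refl x
==-refl (false ∷ x) = ==-refl x

==-complete : ∀ {v} {x y : Vect v} → x ≡ y → (x == y) ≡ true
==-complete {x = x} refl = ==-refl x

==-sound : ∀ {v} {x y : Vect v} → (x == y) ≡ true → x ≡ y
==-sound {x = []} {[]} _ = refl
==-sound {x = true ∷ x} {true ∷ y} p = cong (true ∷_) (==-sound p)
==-sound {x = false ∷ x} {false ∷ y} p = cong (false ∷_) (==-sound p)

==-false : ∀ {v} {x y : Vect v} → x ≢ y → (x == y) ≡ false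
==-false ne = ≢true (λ e → ne (==-sound e))

≢-sound : ∀ {v} {x y : Vect v} → not (x == y) ≡ true → x ≢ y
≢-sound h e with trans (sym (cong not (==-complete e))) h
... | ()

≢-complete : ∀ {v} {x y : Vect v} → x ≢ y → not (x == y) ≡ true
≢-complete ne = cong not (==-false ne)

_≟v_ : ∀ {v} → DecidableEquality (Vect v)
_≟v_ = VP.≡-dec BP._≟_

vext : ∀ {v} {x y : Vect v} → (∀ j → lookup x j ≡ lookup y j) → x ≡ y
vext {x = x} {y} p = begin
  x                    ≡⟨ VP.tabulate∘lookup x ⟨
  tabulate (lookup x)  ≡⟨ VP.tabulate-cong p ⟩
  tabulate (lookup y)  ≡⟨ VP.tabulate∘lookup y ⟩
  y                    ∎
  where open ≡-Reasoning

lookup-⊕ : ∀ {v} (x y : Vect v) j → lookup (x ⊕ y) j ≡ lookup x j xor lookup y j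
lookup-⊕ x y j = VP.lookup-zipWith _xor_ j x y

lookup-0 : ∀ {v} j → lookup (zeroV v) j ≡ false
lookup-0 {v} j = VP.lookup-replicate j false

allVecs-complete : ∀ {v} (x : Vect v) → x ∈ allVecs v
allVecs-complete [] = here refl
allVecs-complete {suc v} (false ∷ x) = MP.∈-++⁺ˡ (MP.∈-map⁺ (false ∷_) (allVecs-complete x))
allVecs-complete {suc v} (true ∷ x) =
  MP.∈-++⁺ʳ (map (false ∷_) (allVecs v)) (MP.∈-map⁺ (true ∷_) (allVecs-complete x))

all-elim : ∀ {A : Set} (p : A → Bool) {xs : List A} → all p xs ≡ true → ∀ {x} → x ∈ xs → p x ≡ true
all-elim p h (here refl) = ∧-true-l h
all-elim p {y ∷ _} h (there m) = all-elim p (∧-true-r {p y} h) m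

all-intro : ∀ {A : Set} (p : A → Bool) (xs : List A) → (∀ x → p x ≡ true) → all p xs ≡ true
all-intro p [] h = refl
all-intro p (y ∷ ys) h = ∧-true (h y) (all-intro p ys h)

all-counterexample : ∀ {A : Set} (p : A → Bool) (xs : List A) → all p xs ≡ false → Σ A (λ x → p x ≡ false)
all-counterexample p (y ∷ ys) h with p y in eq
... | false = y , eq
... | true = all-counterexample p ys h

any-elim : ∀ {A : Set} (p : A → Bool) (xs : List A) → any p xs ≡ true → Σ A (λ x → x ∈ xs × p x ≡ true)
any-elim p (y ∷ ys) h with p y in eq
... | true = y , here refl , eq
... | false with any-elim p ys h
...   | x , m , px = x , there m , px

any-intro : ∀ {A : Set} (p : A → Bool) {xs : List A} {x} → x ∈ xs → p x ≡ true → any p xs ≡ true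
any-intro p (here refl) h rewrite h = refl
any-intro p {y ∷ _} (there m) h with p y
... | true = refl
... | false = any-intro p m h

allV : ∀ {v} (p : Vect v → Bool) → all p (allVecs v) ≡ true → ∀ x → p x ≡ true
allV p h x = all-elim p h (allVecs-complete x)

⊆ᵇ-elim : ∀ {v} (L B : VSet v) → (L ⊆ᵇ B) ≡ true → ∀ z → L z ≡ true → B z ≡ true
⊆ᵇ-elim L B h z lz with allV (λ x → not (L x) ∨ B x) h z
... | r rewrite lz = r

⊆ᵇ-intro : ∀ {v} (L B : VSet v) → (∀ z → L z ≡ true → B z ≡ true) → (L ⊆ᵇ B) ≡ true
⊆ᵇ-intro {v} L B h = all-intro _ (allVecs v) member
  where
  member : ∀ z → (not (L z) ∨ B z) ≡ true
  member z with L z in eq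
  ... | true = h z eq
  ... | false = refl

-- A decision procedure for identities in the group (F₂^v, ⊕): an identity
-- between ⊕-expressions in n variables holds for vectors as soon as it
-- holds coordinatewise, i.e. for all 2^n boolean assignments.
data XorExpr (n : ℕ) : Set where
  var : Fin n → XorExpr n
  𝟘 : XorExpr n
  _⊕'_ : XorExpr n → XorExpr n → XorExpr n

infixl 6 _⊕'_

⟦_⟧ : ∀ {n v} → XorExpr n → Vec (Vect v) n → Vect v
⟦ var i ⟧ ρ = lookup ρ i
⟦_⟧ {v = v} 𝟘 ρ = zeroV v
⟦ e ⊕' e' ⟧ ρ = ⟦ e ⟧ ρ ⊕ ⟦ e' ⟧ ρ

⟦_⟧ᵇ : ∀ {n} → XorExpr n → Vec Bool n → Bool
⟦ var i ⟧ᵇ ρ = lookup ρ i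
⟦ 𝟘 ⟧ᵇ ρ = false
⟦ e ⊕' e' ⟧ᵇ ρ = ⟦ e ⟧ᵇ ρ xor ⟦ e' ⟧ᵇ ρ

lookup-⟦⟧ : ∀ {n v} (e : XorExpr n) (ρ : Vec (Vect v) n) j →
  lookup (⟦ e ⟧ ρ) j ≡ ⟦ e ⟧ᵇ (V.map (λ x → lookup x j) ρ)
lookup-⟦⟧ (var i) ρ j = sym (VP.lookup-map i (λ x → lookup x j) ρ)
lookup-⟦⟧ 𝟘 ρ j = lookup-0 j
lookup-⟦⟧ (e ⊕' e') ρ j =
  trans (lookup-⊕ (⟦ e ⟧ ρ) (⟦ e' ⟧ ρ) j) (cong₂ _xor_ (lookup-⟦⟧ e ρ j) (lookup-⟦⟧ e' ρ j))

xor-solve : ∀ {n v} (e e' : XorExpr n) →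
  all (λ σ → not (⟦ e ⟧ᵇ σ xor ⟦ e' ⟧ᵇ σ)) (allVecs n) ≡ true →
  (ρ : Vec (Vect v) n) → ⟦ e ⟧ ρ ≡ ⟦ e' ⟧ ρ
xor-solve {n} {v} e e' h ρ = vext λ j → begin
  lookup (⟦ e ⟧ ρ) j          ≡⟨ lookup-⟦⟧ e ρ j ⟩
  ⟦ e ⟧ᵇ (coords j)           ≡⟨ xnor-sound (allV _ h (coords j)) ⟩
  ⟦ e' ⟧ᵇ (coords j)          ≡⟨ lookup-⟦⟧ e' ρ j ⟨
  lookup (⟦ e' ⟧ ρ) j         ∎
  where
  open ≡-Reasoning
  coords : Fin v → Vec Bool n
  coords j = V.map (λ x → lookup x j) ρ

x₀ : ∀ {n} → XorExpr (suc n)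
x₀ = var F.zero
x₁ : ∀ {n} → XorExpr (2 + n)
x₁ = var (F.suc F.zero)
x₂ : ∀ {n} → XorExpr (3 + n)
x₂ = var (F.suc (F.suc F.zero))
x₃ : ∀ {n} → XorExpr (4 + n)
x₃ = var (F.suc (F.suc (F.suc F.zero)))
x₄ : ∀ {n} → XorExpr (5 + n)
x₄ = var (F.suc (F.suc (F.suc (F.suc F.zero))))
x₅ : ∀ {n} → XorExpr (6 + n)
x₅ = var (F.suc (F.suc (F.suc (F.suc (F.suc F.zero)))))

⊕-identityʳ : ∀ {v} (a : Vect v) → a ⊕ zeroV v ≡ a
⊕-identityʳ a = xor-solve (x₀ ⊕' 𝟘) x₀ refl (a ∷ [])

⊕-self : ∀ {v} (a : Vect v) → a ⊕ a ≡ zeroV v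
⊕-self a = xor-solve (x₀ ⊕' x₀) 𝟘 refl (a ∷ [])

⊕-comm : ∀ {v} (a b : Vect v) → a ⊕ b ≡ b ⊕ a
⊕-comm a b = xor-solve (x₀ ⊕' x₁) (x₁ ⊕' x₀) refl (a ∷ b ∷ [])

⊕-solveʳ : ∀ {v} {a b c : Vect v} → a ⊕ b ≡ c → b ≡ a ⊕ c
⊕-solveʳ {a = a} {b} e = trans (xor-solve x₁ (x₀ ⊕' (x₀ ⊕' x₁)) refl (a ∷ b ∷ [])) (cong (a ⊕_) e)

⊕-solveˡ : ∀ {v} {a b c : Vect v} → a ⊕ b ≡ c → a ≡ b ⊕ c
⊕-solveˡ {a = a} {b} e = ⊕-solveʳ (trans (⊕-comm b a) e)

⊕≡0⇒≡ : ∀ {v} {a b : Vect v} → a ⊕ b ≡ zeroV v → a ≡ b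
⊕≡0⇒≡ {b = b} e = trans (⊕-solveˡ e) (⊕-identityʳ b)

⊕-cancelˡ : ∀ {v} (a : Vect v) {b c} → a ⊕ b ≡ a ⊕ c → b ≡ c
⊕-cancelˡ a {b} {c} e = trans (⊕-solveʳ e) (xor-solve (x₀ ⊕' (x₀ ⊕' x₁)) x₁ refl (a ∷ c ∷ []))

⊕≡self⇒0 : ∀ {v} {a b : Vect v} → a ⊕ b ≡ a → b ≡ zeroV v
⊕≡self⇒0 {a = a} e = trans (⊕-solveʳ e) (⊕-self a)

χ : Bool → ℕ
χ true = 1
χ false = 0

χ-∧ : ∀ a b → χ (a ∧ b) ≡ χ a * χ b
χ-∧ true b = sym (NP.+-identityʳ (χ b))
χ-∧ false b = refl

Σl : ∀ {A : Set} → List A → (A → ℕ) → ℕ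
Σl [] f = 0
Σl (x ∷ xs) f = f x + Σl xs f

count-Σ : ∀ {A : Set} (p : A → Bool) (xs : List A) →
  length (filter (λ x → T? (p x)) xs) ≡ Σl xs (λ x → χ (p x))
count-Σ p [] = refl
count-Σ p (x ∷ xs) with p x
... | true = cong suc (count-Σ p xs)
... | false = count-Σ p xs

Σ-cong∈ : ∀ {A : Set} (xs : List A) {f g : A → ℕ} → (∀ x → x ∈ xs → f x ≡ g x) → Σl xs f ≡ Σl xs g
Σ-cong∈ [] h = refl
Σ-cong∈ (x ∷ xs) h = cong₂ _+_ (h x (here refl)) (Σ-cong∈ xs (λ y m → h y (there m)))

Σ-cong : ∀ {A : Set} (xs : List A) {f g : A → ℕ} → (∀ x → f x ≡ g x) → Σl xs f ≡ Σl xs g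
Σ-cong xs h = Σ-cong∈ xs (λ x _ → h x)

Σ-zero : ∀ {A : Set} (xs : List A) {f : A → ℕ} → (∀ x → f x ≡ 0) → Σl xs f ≡ 0
Σ-zero [] h = refl
Σ-zero (x ∷ xs) h rewrite h x = Σ-zero xs h

Σ-+ : ∀ {A : Set} (xs : List A) (f g : A → ℕ) → Σl xs (λ x → f x + g x) ≡ Σl xs f + Σl xs g
Σ-+ [] f g = refl
Σ-+ (x ∷ xs) f g rewrite Σ-+ xs f g = +-interchange (f x) (g x) (Σl xs f) (Σl xs g)

Σ-*ʳ : ∀ {A : Set} (xs : List A) (f : A → ℕ) c → Σl xs (λ x → f x * c) ≡ Σl xs f * c
Σ-*ʳ [] f c = refl
Σ-*ʳ (x ∷ xs) f c rewrite Σ-*ʳ xs f c = sym (NP.*-distribʳ-+ c (f x) (Σl xs f))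

Σ-*ˡ : ∀ {A : Set} (xs : List A) (f : A → ℕ) c → Σl xs (λ x → c * f x) ≡ c * Σl xs f
Σ-*ˡ [] f c = sym (NP.*-zeroʳ c)
Σ-*ˡ (x ∷ xs) f c rewrite Σ-*ˡ xs f c = sym (NP.*-distribˡ-+ c (f x) (Σl xs f))

Σ-++ : ∀ {A : Set} (xs ys : List A) (f : A → ℕ) → Σl (xs ++ ys) f ≡ Σl xs f + Σl ys f
Σ-++ [] ys f = refl
Σ-++ (x ∷ xs) ys f rewrite Σ-++ xs ys f = sym (NP.+-assoc (f x) (Σl xs f) (Σl ys f))

Σ-map : ∀ {A B : Set} (h : A → B) (xs : List A) (f : B → ℕ) → Σl (map h xs) f ≡ Σl xs (λ x → f (h x))
Σ-map h [] f = refl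
Σ-map h (x ∷ xs) f = cong (f (h x) +_) (Σ-map h xs f)

Σ-swap : ∀ {A B : Set} (xs : List A) (ys : List B) (f : A → B → ℕ) →
  Σl xs (λ x → Σl ys (λ y → f x y)) ≡ Σl ys (λ y → Σl xs (λ x → f x y))
Σ-swap [] ys f = sym (Σ-zero ys (λ _ → refl))
Σ-swap (x ∷ xs) ys f rewrite Σ-swap xs ys f = sym (Σ-+ ys (f x) (λ y → Σl xs (λ x₁ → f x₁ y)))

ΣV : ∀ {v} → (Vect v → ℕ) → ℕ
ΣV {v} f = Σl (allVecs v) f

#_ : ∀ {v} → VSet v → ℕ
# S = ΣV (λ z → χ (S z))

card≡# : ∀ {v} (S : VSet v) → card S ≡ # S
card≡# {v} S = count-Σ S (allVecs v)

ΣV-split : ∀ {v} (g : Vect (suc v) → ℕ) → ΣV g ≡ ΣV (λ z → g (false ∷ z)) + ΣV (λ z → g (true ∷ z))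
ΣV-split {v} g = trans (Σ-++ (map (false ∷_) (allVecs v)) (map (true ∷_) (allVecs v)) g)
  (cong₂ _+_ (Σ-map (false ∷_) (allVecs v) g) (Σ-map (true ∷_) (allVecs v) g))

#-singleton : ∀ {v} (a : Vect v) → # (_== a) ≡ 1
#-singleton {zero} [] = refl
#-singleton {suc v} (b ∷ a) = trans (ΣV-split (λ z → χ (z == (b ∷ a)))) (halves b)
  where
  halves : ∀ b → Σl (allVecs v) (λ z → χ ((false ∷ z) == (b ∷ a))) + Σl (allVecs v) (λ z → χ ((true ∷ z) == (b ∷ a))) ≡ 1
  halves false = cong₂ _+_ (#-singleton a) (Σ-zero (allVecs v) (λ _ → refl))
  halves true = cong₂ _+_ (Σ-zero (allVecs v) (λ _ → refl)) (#-singleton a)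

ΣV-point : ∀ {v} (a : Vect v) (g : Vect v → ℕ) → ΣV (λ z → χ (z == a) * g z) ≡ g a
ΣV-point {v} a g = begin
  ΣV (λ z → χ (z == a) * g z)   ≡⟨ Σ-cong (allVecs v) evaluate ⟩
  ΣV (λ z → χ (z == a) * g a)   ≡⟨ Σ-*ʳ (allVecs v) (λ z → χ (z == a)) (g a) ⟩
  # (_== a) * g a               ≡⟨ cong (_* g a) (#-singleton a) ⟩
  1 * g a                       ≡⟨ NP.*-identityˡ (g a) ⟩
  g a                           ∎
  where
  open ≡-Reasoning
  evaluate : ∀ z → χ (z == a) * g z ≡ χ (z == a) * g a
  evaluate z with z == a in eq
  ... | true = cong (λ t → 1 * g t) (==-sound eq)
  ... | false = refl

_∖_ : ∀ {v} → VSet v → Vect v → VSet v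
(S ∖ a) z = S z ∧ not (z == a)

#-∖ : ∀ {v} (S : VSet v) {a} → S a ≡ true → # S ≡ suc (# (S ∖ a))
#-∖ {v} S {a} h = trans (Σ-cong (allVecs v) split) (trans (Σ-+ (allVecs v) (λ z → χ (z == a)) _)
  (cong (_+ # (S ∖ a)) (#-singleton a)))
  where
  split : ∀ z → χ (S z) ≡ χ (z == a) + χ ((S ∖ a) z)
  split z with z == a in eq
  ... | true with refl ← ==-sound {x = z} {a} eq rewrite h = refl
  ... | false rewrite BP.∧-identityʳ (S z) = refl

∖-intro : ∀ {v} (S : VSet v) {a b} → S b ≡ true → b ≢ a → (S ∖ a) b ≡ true
∖-intro S {a} {b} h ne rewrite h | ==-false ne = refl

∖-elim : ∀ {v} (S : VSet v) {a z} → (S ∖ a) z ≡ true → (S z ≡ true) × (z ≢ a)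
∖-elim S {z = z} h = ∧-true-l h , ≢-sound (∧-true-r {S z} h)

length≤# : ∀ {v} (S : VSet v) (as : List (Vect v)) → Unique as → All (λ a → S a ≡ true) as → length as ≤ # S
length≤# S [] _ _ = z≤n
length≤# S (a ∷ as) (a∉ ∷ distinct) (Sa ∷ Sas) rewrite #-∖ S Sa =
  s≤s (length≤# (S ∖ a) as distinct (All.zipWith (λ (a≢b , Sb) → ∖-intro S Sb (λ e → a≢b (sym e))) (a∉ , Sas)))

#-list : ∀ {v} (S : VSet v) (as : List (Vect v)) → Unique as →
  (∀ z → S z ≡ true → z ∈ as) → (∀ z → z ∈ as → S z ≡ true) → # S ≡ length as
#-list {v} S [] _ onlyAs _ = Σ-zero (allVecs v) (λ z → cong χ (≢true (λ Sz → nothing∈[] (onlyAs z Sz))))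
  where
  nothing∈[] : ∀ {z : Vect v} → z ∈ [] → ⊥
  nothing∈[] ()
#-list S (a ∷ as) (a∉ ∷ distinct) onlyAs allAs =
  trans (#-∖ S (allAs a (here refl))) (cong suc (#-list (S ∖ a) as distinct onlyRest allRest))
  where
  onlyRest : ∀ z → (S ∖ a) z ≡ true → z ∈ as
  onlyRest z h with onlyAs z (proj₁ (∖-elim S h))
  ... | here e = ⊥-elim (proj₂ (∖-elim S h) e)
  ... | there m = m
  allRest : ∀ z → z ∈ as → (S ∖ a) z ≡ true
  allRest z m = ∖-intro S (allAs z (there m)) (λ e → All.lookup a∉ m (sym e))

#-full : ∀ {v} (S : VSet v) (as : List (Vect v)) → Unique as → All (λ a → S a ≡ true) as →
  # S ≡ length as → ∀ z → S z ≡ true → z ∈ as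
#-full S as distinct Sas size z Sz with DecMem._∈?_ _≟v_ z as
... | yes z∈as = z∈as
... | no z∉as = ⊥-elim (NP.<-irrefl (sym size) longer)
  where
  longer : suc (length as) ≤ # S
  longer = length≤# S (z ∷ as) (AllP.¬Any⇒All¬ as z∉as ∷ distinct) (Sz ∷ Sas)

#-pairs : ∀ {v} (S : VSet v) N → # S ≡ N → ΣV (λ x → ΣV (λ y → χ (S x ∧ (S ∖ x) y))) ≡ N * (N ∸ 1)
#-pairs {v} S N size = begin
  ΣV (λ x → ΣV (λ y → χ (S x ∧ (S ∖ x) y)))      ≡⟨ Σ-cong (allVecs v) factor ⟩
  ΣV (λ x → χ (S x) * # (S ∖ x))                  ≡⟨ Σ-cong (allVecs v) rest ⟩
  ΣV (λ x → χ (S x) * (N ∸ 1))                    ≡⟨ Σ-*ʳ (allVecs v) (λ x → χ (S x)) (N ∸ 1) ⟩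
  # S * (N ∸ 1)                                   ≡⟨ cong (_* (N ∸ 1)) size ⟩
  N * (N ∸ 1)                                     ∎
  where
  open ≡-Reasoning
  factor : ∀ x → ΣV (λ y → χ (S x ∧ (S ∖ x) y)) ≡ χ (S x) * # (S ∖ x)
  factor x = trans (Σ-cong (allVecs v) (λ y → χ-∧ (S x) ((S ∖ x) y))) (Σ-*ˡ (allVecs v) _ (χ (S x)))
  rest : ∀ x → χ (S x) * # (S ∖ x) ≡ χ (S x) * (N ∸ 1)
  rest x with S x in Sx
  ... | false = refl
  ... | true = cong (1 *_) (cong (_∸ 1) (trans (sym (#-∖ S Sx)) size))

count≡1⇒unique : ∀ {A : Set} (q : A → Bool) (xs : List A) {a b} → a ∈ xs → b ∈ xs → q a ≡ true → q b ≡ true →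
  length (filter (λ x → T? (q x)) xs) ≡ 1 → a ≡ b
count≡1⇒unique q xs a∈ b∈ qa qb one = go xs a∈ b∈ qa qb (trans (sym (count-Σ q xs)) one)
  where
  positive : ∀ ys {c} → c ∈ ys → q c ≡ true → Σl ys (λ x → χ (q x)) ≢ 0
  positive (y ∷ ys) (here refl) qc e rewrite qc = NP.1+n≢0 e
  positive (y ∷ ys) (there m) qc e with q y
  ... | true = NP.1+n≢0 e
  ... | false = positive ys m qc e
  go : ∀ ys {a b} → a ∈ ys → b ∈ ys → q a ≡ true → q b ≡ true → Σl ys (λ x → χ (q x)) ≡ 1 → a ≡ b
  go (y ∷ ys) (here refl) (here refl) qa qb e = refl
  go (y ∷ ys) (here refl) (there b∈) qa qb e rewrite qa = ⊥-elim (positive ys b∈ qb (NP.suc-injective e))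
  go (y ∷ ys) (there a∈) (here refl) qa qb e rewrite qb = ⊥-elim (positive ys a∈ qa (NP.suc-injective e))
  go (y ∷ ys) (there a∈) (there b∈) qa qb e with q y
  ... | true = ⊥-elim (positive ys a∈ qa (NP.suc-injective e))
  ... | false = go ys a∈ b∈ qa qb e

⟨_,_⟩ : ∀ {v} → Vect v → Vect v → List (Vect v)
⟨_,_⟩ {v} x y = zeroV v ∷ x ∷ y ∷ x ⊕ y ∷ []

span : ∀ {v} → Vect v → Vect v → VSet v
span x y z = any (z ==_) ⟨ x , y ⟩

span-intro : ∀ {v} (x y : Vect v) {z} → z ∈ ⟨ x , y ⟩ → span x y z ≡ true
span-intro x y {z} m = any-intro (z ==_) m (==-refl z)

span-elim : ∀ {v} (x y : Vect v) {z} → span x y z ≡ true → z ∈ ⟨ x , y ⟩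
span-elim x y {z} h with any-elim (z ==_) ⟨ x , y ⟩ h
... | a , m , za = subst (_∈ ⟨ x , y ⟩) (sym (==-sound za)) m

span-closed : ∀ {v} {x y a b : Vect v} → a ∈ ⟨ x , y ⟩ → b ∈ ⟨ x , y ⟩ → a ⊕ b ∈ ⟨ x , y ⟩
span-closed {v} {x} {y} ma mb = closed ma mb
  where
  s₀ : ∀ {z} → z ≡ zeroV v → z ∈ ⟨ x , y ⟩
  s₀ = here
  s₁ : ∀ {z} → z ≡ x → z ∈ ⟨ x , y ⟩
  s₁ e = there (here e)
  s₂ : ∀ {z} → z ≡ y → z ∈ ⟨ x , y ⟩
  s₂ e = there (there (here e))
  s₃ : ∀ {z} → z ≡ x ⊕ y → z ∈ ⟨ x , y ⟩
  s₃ e = there (there (there (here e)))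
  ρ : Vec (Vect v) 2
  ρ = x ∷ y ∷ []
  closed : ∀ {a b} → a ∈ ⟨ x , y ⟩ → b ∈ ⟨ x , y ⟩ → a ⊕ b ∈ ⟨ x , y ⟩
  closed (here refl) (here refl) = s₀ (⊕-self (zeroV v))
  closed (here refl) (there (here refl)) = s₁ (xor-solve (𝟘 ⊕' x₀) x₀ refl ρ)
  closed (here refl) (there (there (here refl))) = s₂ (xor-solve (𝟘 ⊕' x₁) x₁ refl ρ)
  closed (here refl) (there (there (there (here refl)))) = s₃ (xor-solve (𝟘 ⊕' (x₀ ⊕' x₁)) (x₀ ⊕' x₁) refl ρ)
  closed (there (here refl)) (here refl) = s₁ (⊕-identityʳ x)
  closed (there (here refl)) (there (here refl)) = s₀ (⊕-self x)
  closed (there (here refl)) (there (there (here refl))) = s₃ refl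
  closed (there (here refl)) (there (there (there (here refl)))) = s₂ (xor-solve (x₀ ⊕' (x₀ ⊕' x₁)) x₁ refl ρ)
  closed (there (there (here refl))) (here refl) = s₂ (⊕-identityʳ y)
  closed (there (there (here refl))) (there (here refl)) = s₃ (⊕-comm y x)
  closed (there (there (here refl))) (there (there (here refl))) = s₀ (⊕-self y)
  closed (there (there (here refl))) (there (there (there (here refl)))) = s₁ (xor-solve (x₁ ⊕' (x₀ ⊕' x₁)) x₀ refl ρ)
  closed (there (there (there (here refl)))) (here refl) = s₃ (⊕-identityʳ (x ⊕ y))
  closed (there (there (there (here refl)))) (there (here refl)) = s₂ (xor-solve ((x₀ ⊕' x₁) ⊕' x₀) x₁ refl ρ)
  closed (there (there (there (here refl)))) (there (there (here refl))) = s₁ (xor-solve ((x₀ ⊕' x₁) ⊕' x₁) x₀ refl ρ)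
  closed (there (there (there (here refl)))) (there (there (there (here refl)))) = s₀ (⊕-self (x ⊕ y))

⟨,⟩-unique : ∀ {v} {x y : Vect v} → x ≢ zeroV v → y ≢ zeroV v → x ≢ y → Unique ⟨ x , y ⟩
⟨,⟩-unique {v} {x} {y} x≢0 y≢0 x≢y =
  ((λ e → x≢0 (sym e)) ∷ (λ e → y≢0 (sym e)) ∷ (λ e → x≢y (⊕≡0⇒≡ (sym e))) ∷ []) ∷
  (x≢y ∷ (λ e → y≢0 (⊕≡self⇒0 (sym e))) ∷ []) ∷
  ((λ e → x≢0 (⊕≡self⇒0 (trans (⊕-comm y x) (sym e)))) ∷ []) ∷ [] ∷ []

span⊆ : ∀ {v} k (x y : Vect v) (B : VSet v) → IsSubspace v k B → B x ≡ true → B y ≡ true → (span x y ⊆ᵇ B) ≡ true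
span⊆ {v} k x y B (B0 , B⊕ , _) Bx By = ⊆ᵇ-intro _ B (λ z h → members (span-elim x y {z} h))
  where
  members : ∀ {z} → z ∈ ⟨ x , y ⟩ → B z ≡ true
  members (here refl) = B0
  members (there (here refl)) = Bx
  members (there (there (here refl))) = By
  members (there (there (there (here refl)))) = B⊕ x y Bx By

span-isLine : ∀ {v} {x y : Vect v} → x ≢ zeroV v → y ≢ zeroV v → x ≢ y → IsSubspace v 2 (span x y)
span-isLine {v} {x} {y} x≢0 y≢0 x≢y =
  span-intro x y (here refl) ,
  (λ a b ha hb → span-intro x y (span-closed (span-elim x y {a} ha) (span-elim x y {b} hb))) ,
  trans (card≡# (span x y))
        (#-list (span x y) ⟨ x , y ⟩ (⟨,⟩-unique x≢0 y≢0 x≢y) (λ z → span-elim x y {z}) (λ z → span-intro x y {z}))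

span-∋x : ∀ {v} (x y : Vect v) → span x y x ≡ true
span-∋x x y = span-intro x y (there (here refl))

span-∋y : ∀ {v} (x y : Vect v) → span x y y ≡ true
span-∋y x y = span-intro x y (there (there (here refl)))

⊕-rearrange : ∀ {v} {a b a' b' : Vect v} → a ⊕ b ≡ a' ⊕ b' → b ⊕ b' ≡ a ⊕ a'
⊕-rearrange {v} {a} {b} {a'} {b'} e = begin
  b ⊕ b'                                ≡⟨ xor-solve (x₁ ⊕' x₃) (x₀ ⊕' x₂ ⊕' ((x₀ ⊕' x₁) ⊕' (x₂ ⊕' x₃))) refl ρ ⟩
  (a ⊕ a') ⊕ ((a ⊕ b) ⊕ (a' ⊕ b'))      ≡⟨ cong (λ t → (a ⊕ a') ⊕ (t ⊕ (a' ⊕ b'))) e ⟩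
  (a ⊕ a') ⊕ ((a' ⊕ b') ⊕ (a' ⊕ b'))    ≡⟨ cong ((a ⊕ a') ⊕_) (⊕-self (a' ⊕ b')) ⟩
  (a ⊕ a') ⊕ zeroV v                    ≡⟨ ⊕-identityʳ (a ⊕ a') ⟩
  a ⊕ a'                                ∎
  where
  open ≡-Reasoning
  ρ : Vec (Vect v) 4
  ρ = a ∷ b ∷ a' ∷ b' ∷ []

coset-sums-unique : ∀ {v} (U : Vect v → Set) → (∀ {a a'} → U a → U a' → U (a ⊕ a')) →
  (as bs : List (Vect v)) → All U as → Unique as → Unique bs →
  (∀ {b b'} → b ∈ bs → b' ∈ bs → U (b ⊕ b') → b ≡ b') →
  Unique (cartesianProductWith _⊕_ as bs)
coset-sums-unique U U⊕ [] bs _ _ _ _ = []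
coset-sums-unique U U⊕ (a ∷ as) bs (Ua ∷ Uas) (a∉ ∷ distinct) bsDistinct sameCoset =
  UniqueP.++⁺ (UniqueP.map⁺ (⊕-cancelˡ a) bsDistinct)
              (coset-sums-unique U U⊕ as bs Uas distinct bsDistinct sameCoset)
              disjoint
  where
  disjoint : ∀ {c} → ¬ (c ∈ map (a ⊕_) bs × c ∈ cartesianProductWith _⊕_ as bs)
  disjoint (c∈ , c∈') with MP.∈-map⁻ (a ⊕_) c∈ | MP.∈-cartesianProductWith⁻ _⊕_ as bs c∈'
  ... | b , b∈ , refl | a' , b' , a'∈ , b'∈ , e with ⊕-rearrange e
  ...   | e' with sameCoset b∈ b'∈ (subst U (sym e') (U⊕ Ua (All.lookup Uas a'∈)))
  ...     | refl = All.lookup a∉ a'∈ (⊕-cancelˡ b (trans (⊕-comm b a) (trans e (⊕-comm a' b))))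

coset-sums-∈ : ∀ {v} (S : VSet v) → (∀ a b → S a ≡ true → S b ≡ true → S (a ⊕ b) ≡ true) →
  (as bs : List (Vect v)) → All (λ a → S a ≡ true) as → All (λ b → S b ≡ true) bs →
  All (λ c → S c ≡ true) (cartesianProductWith _⊕_ as bs)
coset-sums-∈ S S⊕ as bs Sas Sbs = All.tabulate member
  where
  member : ∀ {c} → c ∈ cartesianProductWith _⊕_ as bs → S c ≡ true
  member c∈ with MP.∈-cartesianProductWith⁻ _⊕_ as bs c∈
  ... | a , b , a∈ , b∈ , refl = S⊕ a b (All.lookup Sas a∈) (All.lookup Sbs b∈)

All-⟨,⟩ : ∀ {v} (Q : Vect v → Set) {x y : Vect v} → Q (zeroV v) → Q x → Q y →
  (∀ {a b} → Q a → Q b → Q (a ⊕ b)) → All Q ⟨ x , y ⟩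
All-⟨,⟩ Q Q0 Qx Qy Q⊕ = Q0 ∷ Qx ∷ Qy ∷ Q⊕ Qx Qy ∷ []

#-subspace : ∀ {v} k {B : VSet v} → IsSubspace v k B → # B ≡ 2 ^ k
#-subspace k {B} (_ , _ , size) = trans (sym (card≡# B)) size

⨁ : ∀ {n} → (Fin n → Bool) → Bool
⨁ g = L.foldr _xor_ false (V.toList (tabulate g))

⨁-cong : ∀ {n} {g h : Fin n → Bool} → (∀ i → g i ≡ h i) → ⨁ g ≡ ⨁ h
⨁-cong p = cong (λ t → L.foldr _xor_ false (V.toList t)) (VP.tabulate-cong p)

⨁-xor : ∀ {n} (g h : Fin n → Bool) → ⨁ (λ i → g i xor h i) ≡ ⨁ g xor ⨁ h
⨁-xor {zero} g h = refl
⨁-xor {suc n} g h = trans (cong ((g F.zero xor h F.zero) xor_) (⨁-xor (g ∘ F.suc) (h ∘ F.suc)))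
  (xor-interchange (g F.zero) (h F.zero) (⨁ (g ∘ F.suc)) (⨁ (h ∘ F.suc)))

⨁-zero : ∀ {n} (g : Fin n → Bool) → (∀ i → g i ≡ false) → ⨁ g ≡ false
⨁-zero {zero} g h = refl
⨁-zero {suc n} g h rewrite h F.zero = ⨁-zero (g ∘ F.suc) (h ∘ F.suc)

⨁-single : ∀ {n} (g : Fin n → Bool) (k : Fin n) → (∀ i → i ≢ k → g i ≡ false) → ⨁ g ≡ g k
⨁-single {suc n} g F.zero h =
  trans (cong (g F.zero xor_) (⨁-zero (g ∘ F.suc) (λ i → h (F.suc i) (λ ())))) (BP.xor-identityʳ (g F.zero))
⨁-single {suc n} g (F.suc k) h rewrite h F.zero (λ ()) =
  ⨁-single (g ∘ F.suc) k (λ i ne → h (F.suc i) (λ e → ne (FP.suc-injective e)))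

⨁-pair : ∀ {n} (g : Fin n → Bool) (k₁ k₂ : Fin n) → k₁ ≢ k₂ →
  (∀ i → i ≢ k₁ → i ≢ k₂ → g i ≡ false) → ⨁ g ≡ g k₁ xor g k₂
⨁-pair {n} g k₁ k₂ k₁≢k₂ h = begin
  ⨁ g                              ≡⟨ ⨁-cong split ⟩
  ⨁ (λ i → only k₁ i xor only k₂ i) ≡⟨ ⨁-xor (only k₁) (only k₂) ⟩
  ⨁ (only k₁) xor ⨁ (only k₂)     ≡⟨ cong₂ _xor_ (only-sum k₁) (only-sum k₂) ⟩
  g k₁ xor g k₂                    ∎
  where
  open ≡-Reasoning
  only : Fin n → Fin n → Bool
  only k i with i F.≟ k
  ... | yes _ = g i
  ... | no _ = false
  only-sum : ∀ k → ⨁ (only k) ≡ g k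
  only-sum k = trans (⨁-single (only k) k outside) at-k
    where
    outside : ∀ i → i ≢ k → only k i ≡ false
    outside i ne with i F.≟ k
    ... | yes e = ⊥-elim (ne e)
    ... | no _ = refl
    at-k : only k k ≡ g k
    at-k with k F.≟ k
    ... | yes _ = refl
    ... | no ne = ⊥-elim (ne refl)
  split : ∀ i → g i ≡ only k₁ i xor only k₂ i
  split i with i F.≟ k₁ | i F.≟ k₂
  ... | yes refl | yes refl = ⊥-elim (k₁≢k₂ refl)
  ... | yes _ | no _ = sym (BP.xor-identityʳ (g i))
  ... | no _ | yes _ = refl
  ... | no n₁ | no n₂ = h i n₁ n₂

lookup-· : ∀ {v} (x : Vect v) (M : Mat v) j → lookup (x · M) j ≡ ⨁ (λ i → lookup x i ∧ M i j)
lookup-· x M j = VP.lookup∘tabulate _ j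

∧-distribʳ-xor : ∀ a b c → (a xor b) ∧ c ≡ (a ∧ c) xor (b ∧ c)
∧-distribʳ-xor a b true rewrite BP.∧-identityʳ (a xor b) | BP.∧-identityʳ a | BP.∧-identityʳ b = refl
∧-distribʳ-xor a b false rewrite BP.∧-zeroʳ (a xor b) | BP.∧-zeroʳ a | BP.∧-zeroʳ b = refl

·-linear : ∀ {v} (M : Mat v) (x y : Vect v) → (x ⊕ y) · M ≡ (x · M) ⊕ (y · M)
·-linear M x y = vext λ j → begin
  lookup ((x ⊕ y) · M) j                                      ≡⟨ lookup-· (x ⊕ y) M j ⟩
  ⨁ (λ i → lookup (x ⊕ y) i ∧ M i j)                          ≡⟨ ⨁-cong (distrib j) ⟩
  ⨁ (λ i → (lookup x i ∧ M i j) xor (lookup y i ∧ M i j))     ≡⟨ ⨁-xor (λ i → lookup x i ∧ M i j) (λ i → lookup y i ∧ M i j) ⟩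
  ⨁ (λ i → lookup x i ∧ M i j) xor ⨁ (λ i → lookup y i ∧ M i j) ≡⟨ cong₂ _xor_ (lookup-· x M j) (lookup-· y M j) ⟨
  lookup (x · M) j xor lookup (y · M) j                       ≡⟨ lookup-⊕ (x · M) (y · M) j ⟨
  lookup ((x · M) ⊕ (y · M)) j                                ∎
  where
  open ≡-Reasoning
  distrib : ∀ j i → lookup (x ⊕ y) i ∧ M i j ≡ (lookup x i ∧ M i j) xor (lookup y i ∧ M i j)
  distrib j i = trans (cong (_∧ M i j) (lookup-⊕ x y i)) (∧-distribʳ-xor (lookup x i) (lookup y i) (M i j))

val-injective : ∀ {v} (x y : Vect v) → val x ≡ val y → x ≡ y
val-injective [] [] e = refl
val-injective (true ∷ x) (true ∷ y) e = cong (true ∷_) (val-injective x y (NP.*-cancelˡ-≡ (val x) (val y) 2 (NP.suc-injective e)))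
val-injective (false ∷ x) (false ∷ y) e = cong (false ∷_) (val-injective x y (NP.*-cancelˡ-≡ (val x) (val y) 2 e))
val-injective (true ∷ x) (false ∷ y) e = ⊥-elim (NP.even≢odd (val y) (val x) (sym e))
val-injective (false ∷ x) (true ∷ y) e = ⊥-elim (NP.even≢odd (val x) (val y) e)

T⇒≡true : ∀ {b} → T b → b ≡ true
T⇒≡true {true} _ = refl

<⇒≤ᵇ : ∀ {m n} → m < n → (m ≤ᵇ n) ≡ true
<⇒≤ᵇ m<n = T⇒≡true (NP.≤⇒≤ᵇ (NP.<⇒≤ m<n))

<⇒≰ᵇ : ∀ {m n} → m < n → (n ≤ᵇ m) ≡ false
<⇒≰ᵇ {m} {n} m<n = ≢true (λ n≤m → NP.<⇒≱ m<n (NP.≤ᵇ⇒≤ n m (subst T (sym n≤m) _)))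

exactlyOneLeast : ∀ a b c → a ≢ b → b ≢ c → a ≢ c →
  χ ((a ≤ᵇ b) ∧ (a ≤ᵇ c)) + (χ ((b ≤ᵇ c) ∧ (b ≤ᵇ a)) + χ ((c ≤ᵇ a) ∧ (c ≤ᵇ b))) ≡ 1
exactlyOneLeast a b c a≢b b≢c a≢c with NP.<-cmp a b | NP.<-cmp b c | NP.<-cmp a c
... | tri≈ _ e _ | _ | _ = ⊥-elim (a≢b e)
... | _ | tri≈ _ e _ | _ = ⊥-elim (b≢c e)
... | _ | _ | tri≈ _ e _ = ⊥-elim (a≢c e)
... | tri< p _ _ | tri< q _ _ | tri> _ _ r = ⊥-elim (NP.<-asym (NP.<-trans p q) r)
... | tri> _ _ p | tri> _ _ q | tri< r _ _ = ⊥-elim (NP.<-asym (NP.<-trans q p) r)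
... | tri< p _ _ | tri< q _ _ | tri< r _ _ rewrite <⇒≤ᵇ p | <⇒≰ᵇ p | <⇒≤ᵇ q | <⇒≰ᵇ q | <⇒≤ᵇ r | <⇒≰ᵇ r = refl
... | tri< p _ _ | tri> _ _ q | tri< r _ _ rewrite <⇒≤ᵇ p | <⇒≰ᵇ p | <⇒≤ᵇ q | <⇒≰ᵇ q | <⇒≤ᵇ r | <⇒≰ᵇ r = refl
... | tri< p _ _ | tri> _ _ q | tri> _ _ r rewrite <⇒≤ᵇ p | <⇒≰ᵇ p | <⇒≤ᵇ q | <⇒≰ᵇ q | <⇒≤ᵇ r | <⇒≰ᵇ r = refl
... | tri> _ _ p | tri< q _ _ | tri< r _ _ rewrite <⇒≤ᵇ p | <⇒≰ᵇ p | <⇒≤ᵇ q | <⇒≰ᵇ q | <⇒≰ᵇ r = refl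
... | tri> _ _ p | tri< q _ _ | tri> _ _ r rewrite <⇒≤ᵇ p | <⇒≰ᵇ p | <⇒≤ᵇ q | <⇒≰ᵇ q | <⇒≤ᵇ r = refl
... | tri> _ _ p | tri> _ _ q | tri> _ _ r rewrite <⇒≤ᵇ p | <⇒≰ᵇ p | <⇒≤ᵇ q | <⇒≰ᵇ q | <⇒≤ᵇ r = refl

module OrderThree {v : ℕ} (M : Mat v) (cube : ∀ x → ((x · M) · M) · M ≡ x) where

  P : Vect v → Vect v
  P x = x · M

  0v : Vect v
  0v = zeroV v

  P-⊕ : ∀ x y → P (x ⊕ y) ≡ P x ⊕ P y
  P-⊕ = ·-linear M

  P-0 : P 0v ≡ 0v
  P-0 = ⊕≡self⇒0 (trans (sym (P-⊕ 0v 0v)) (cong P (⊕-self 0v)))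

  P-injective : ∀ {x y} → P x ≡ P y → x ≡ y
  P-injective {x} {y} e = trans (sym (cube x)) (trans (cong (P ∘ P) e) (cube y))

  P≢0 : ∀ {x} → x ≢ 0v → P x ≢ 0v
  P≢0 x≢0 e = x≢0 (P-injective (trans e (sym P-0)))

  IsFixed : Vect v → Set
  IsFixed x = P x ≡ x

  InW : Vect v → Set
  InW x = x ⊕ (P x ⊕ P (P x)) ≡ 0v

  fixed-⊕ : ∀ {x y} → IsFixed x → IsFixed y → IsFixed (x ⊕ y)
  fixed-⊕ {x} {y} Fx Fy = trans (P-⊕ x y) (cong₂ _⊕_ Fx Fy)

  W-0 : InW 0v
  W-0 rewrite P-0 | P-0 = xor-solve {0} (𝟘 ⊕' (𝟘 ⊕' 𝟘)) 𝟘 refl []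

  W-⊕ : ∀ {x y} → InW x → InW y → InW (x ⊕ y)
  W-⊕ {x} {y} Wx Wy = begin
    (x ⊕ y) ⊕ (P (x ⊕ y) ⊕ P (P (x ⊕ y)))
      ≡⟨ cong (λ t → (x ⊕ y) ⊕ t) (cong₂ _⊕_ (P-⊕ x y) (trans (cong P (P-⊕ x y)) (P-⊕ (P x) (P y)))) ⟩
    (x ⊕ y) ⊕ ((P x ⊕ P y) ⊕ (P (P x) ⊕ P (P y)))
      ≡⟨ xor-solve (x₀ ⊕' x₁ ⊕' ((x₂ ⊕' x₃) ⊕' (x₄ ⊕' x₅))) ((x₀ ⊕' (x₂ ⊕' x₄)) ⊕' (x₁ ⊕' (x₃ ⊕' x₅))) refl
                   (x ∷ y ∷ P x ∷ P y ∷ P (P x) ∷ P (P y) ∷ []) ⟩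
    (x ⊕ (P x ⊕ P (P x))) ⊕ (y ⊕ (P y ⊕ P (P y)))
      ≡⟨ cong₂ _⊕_ Wx Wy ⟩
    0v ⊕ 0v
      ≡⟨ ⊕-self 0v ⟩
    0v ∎
    where open ≡-Reasoning

  W-P : ∀ {x} → InW x → InW (P x)
  W-P {x} Wx = begin
    P x ⊕ (P (P x) ⊕ P (P (P x)))  ≡⟨ cong (λ t → P x ⊕ (P (P x) ⊕ t)) (cube x) ⟩
    P x ⊕ (P (P x) ⊕ x)            ≡⟨ xor-solve (x₁ ⊕' (x₂ ⊕' x₀)) (x₀ ⊕' (x₁ ⊕' x₂)) refl (x ∷ P x ∷ P (P x) ∷ []) ⟩
    x ⊕ (P x ⊕ P (P x))            ≡⟨ Wx ⟩
    0v                             ∎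
    where open ≡-Reasoning

  W-P² : ∀ {x} → InW x → P (P x) ≡ x ⊕ P x
  W-P² {x} Wx = sym (⊕≡0⇒≡ (trans (xor-solve (x₀ ⊕' x₁ ⊕' x₂) (x₀ ⊕' (x₁ ⊕' x₂)) refl (x ∷ P x ∷ P (P x) ∷ [])) Wx))

  -- z + P z always lies in W (since 1 + P + P² kills the image of 1 + P).
  W-trace : ∀ z → InW (z ⊕ P z)
  W-trace z = trans (cong ((z ⊕ P z) ⊕_) (cong₂ _⊕_ (P-⊕ z (P z)) P²-sum))
    (xor-solve (x₀ ⊕' x₁ ⊕' (x₁ ⊕' x₂ ⊕' (x₂ ⊕' x₀))) 𝟘 refl (z ∷ P z ∷ P (P z) ∷ []))
    where
    P²-sum : P (P (z ⊕ P z)) ≡ P (P z) ⊕ z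
    P²-sum = trans (cong P (P-⊕ z (P z))) (trans (P-⊕ (P z) (P (P z))) (cong (P (P z) ⊕_) (cube z)))

  fixed∩W : ∀ {x} → IsFixed x → InW x → x ≡ 0v
  fixed∩W {x} Fx Wx = begin
    x                      ≡⟨ xor-solve x₀ (x₀ ⊕' (x₀ ⊕' x₀)) refl (x ∷ []) ⟩
    x ⊕ (x ⊕ x)            ≡⟨ cong (x ⊕_) (cong₂ _⊕_ (sym Fx) (sym (trans (cong P Fx) Fx))) ⟩
    x ⊕ (P x ⊕ P (P x))    ≡⟨ Wx ⟩
    0v                     ∎
    where open ≡-Reasoning

  W-P≢ : ∀ {w} → InW w → w ≢ 0v → P w ≢ w
  W-P≢ Ww w≢0 e = w≢0 (fixed∩W e Ww)

  W-P²≢ : ∀ {w} → InW w → w ≢ 0v → P (P w) ≢ w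
  W-P²≢ {w} Ww w≢0 e = W-P≢ Ww w≢0 (trans (sym (cong P e)) (cube w))

  -- For w ∈ W ∖ 0, ⟨ w , P w ⟩ = {0, w, P w, P² w} is a P-invariant line
  -- contained in W.
  orbit-unique : ∀ {w} → InW w → w ≢ 0v → Unique ⟨ w , P w ⟩
  orbit-unique Ww w≢0 = ⟨,⟩-unique w≢0 (P≢0 w≢0) (λ e → W-P≢ Ww w≢0 (sym e))

  orbit-P : ∀ {w} → InW w → ∀ {a} → a ∈ ⟨ w , P w ⟩ → P a ∈ ⟨ w , P w ⟩
  orbit-P Ww (here refl) = here P-0
  orbit-P Ww (there (here refl)) = there (there (here refl))
  orbit-P Ww (there (there (here refl))) = there (there (there (here (W-P² Ww))))
  orbit-P {w} Ww (there (there (there (here refl)))) =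
    there (here (trans (P-⊕ w (P w)) (trans (cong (P w ⊕_) (W-P² Ww)) (xor-solve (x₁ ⊕' (x₀ ⊕' x₁)) x₀ refl (w ∷ P w ∷ [])))))

  orbit-W : ∀ {w} → InW w → All InW ⟨ w , P w ⟩
  orbit-W Ww = All-⟨,⟩ InW W-0 Ww (W-P Ww) W-⊕

  W-shift : ∀ {q} a → InW q → P q ≡ q ⊕ a → q ≡ P a
  W-shift {q} a Wq e = ⊕≡0⇒≡ (begin
    q ⊕ P a                                   ≡⟨ xor-solve (x₀ ⊕' x₂) (x₀ ⊕' ((x₀ ⊕' x₁) ⊕' ((x₀ ⊕' x₁) ⊕' x₂))) refl (q ∷ a ∷ P a ∷ []) ⟩
    q ⊕ ((q ⊕ a) ⊕ ((q ⊕ a) ⊕ P a))           ≡⟨ cong (q ⊕_) (cong₂ _⊕_ (sym e) (sym P²q)) ⟩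
    q ⊕ (P q ⊕ P (P q))                       ≡⟨ Wq ⟩
    0v                                        ∎)
    where
    open ≡-Reasoning
    P²q : P (P q) ≡ (q ⊕ a) ⊕ P a
    P²q = trans (cong P e) (trans (P-⊕ q a) (cong (_⊕ P a) e))

  onOrbitLine-sound : ∀ x → onOrbitLineᵇ M x ≡ true → (x ≢ 0v) × InW x
  onOrbitLine-sound x h =
    ≢-sound (∧-true-l h) ,
    ==-sound (∧-true-r {P (P (P x)) == x} (∧-true-r {not (P (P x) == x)} (∧-true-r {not (P x == x)} (∧-true-r {not (x == 0v)} h))))

  onOrbitLine-complete : ∀ x → x ≢ 0v → InW x → onOrbitLineᵇ M x ≡ true
  onOrbitLine-complete x x≢0 Wx =
    ∧-true (≢-complete x≢0) (∧-true (≢-complete (W-P≢ Wx x≢0)) (∧-true (≢-complete (W-P²≢ Wx x≢0))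
      (∧-true (==-complete (cube x)) (==-complete Wx))))

  image-P² : ∀ (B : VSet v) y → image M B y ≡ B (P (P y))
  image-P² B y = bool-iff toB fromB
    where
    toB : image M B y ≡ true → B (P (P y)) ≡ true
    toB h with any-elim (λ x → B x ∧ (P x == y)) (allVecs v) h
    ... | x , _ , hx = subst (λ t → B t ≡ true) x≡P²y (∧-true-l hx)
      where
      x≡P²y : x ≡ P (P y)
      x≡P²y = trans (sym (cube x)) (cong (P ∘ P) (==-sound {x = P x} {y} (∧-true-r {B x} hx)))
    fromB : B (P (P y)) ≡ true → image M B y ≡ true
    fromB h = any-intro (λ x → B x ∧ (P x == y)) (allVecs-complete (P (P y))) (∧-true h (==-complete (cube y)))

  Fixes : VSet v → Set
  Fixes B = ∀ y → image M B y ≡ B y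

  isFixed-sound : ∀ B → isFixedᵇ M B ≡ true → Fixes B
  isFixed-sound B h y = xnor-sound (allV (λ y → not (image M B y xor B y)) h y)

  isFixed-complete : ∀ B → Fixes B → isFixedᵇ M B ≡ true
  isFixed-complete B h = all-intro _ (allVecs v) (λ y → subst (λ t → not (t xor B y) ≡ true) (sym (h y)) (xnor-refl (B y)))

  fixes⇒P-closed : ∀ B → Fixes B → ∀ z → B z ≡ true → B (P z) ≡ true
  fixes⇒P-closed B h z Bz = trans (sym (h (P z))) (trans (image-P² B (P z)) (trans (cong B (cube z)) Bz))

  allPointsFixed-sound : ∀ B → allPointsFixedᵇ M B ≡ true → ∀ x → B x ≡ true → IsFixed x
  allPointsFixed-sound B h x Bx with allV (λ x → not (B x) ∨ (P x == x)) h x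
  ... | r rewrite Bx = ==-sound r

  allPointsFixed-complete : ∀ B → (∀ x → B x ≡ true → IsFixed x) → allPointsFixedᵇ M B ≡ true
  allPointsFixed-complete B h = all-intro _ (allVecs v) pointwise
    where
    pointwise : ∀ x → (not (B x) ∨ (P x == x)) ≡ true
    pointwise x with B x in Bx
    ... | true = ==-complete (h x Bx)
    ... | false = refl

  PClosed : VSet v → Set
  PClosed B = ∀ z → B z ≡ true → B (P z) ≡ true

  -- A P-closed plane B containing two distinct nonzero fixed points
  -- is fixed pointwise: for z ∈ B with P z ≠ z, w = z ⊕ P z ∈ W ∖ 0, and the
  -- 16 sums of ⟨ x , y ⟩ ⊆ F and ⟨ w , P w ⟩ ⊆ W would be distinct points of B.
  fixedPointwise : ∀ {B} → IsSubspace v 3 B → PClosed B → ∀ {x y} → B x ≡ true → B y ≡ true →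
    x ≢ 0v → y ≢ 0v → x ≢ y → IsFixed x → IsFixed y → ∀ z → B z ≡ true → IsFixed z
  fixedPointwise {B} B3@(B0 , B⊕ , _) closed {x} {y} Bx By x≢0 y≢0 x≢y Fx Fy z Bz with P z ≟v z
  ... | yes Fz = Fz
  ... | no ¬Fz = ⊥-elim (from-no (16 NP.≤? 8) 16≤8)
    where
    w : Vect v
    w = z ⊕ P z
    Ww : InW w
    Ww = W-trace z
    w≢0 : w ≢ 0v
    w≢0 e = ¬Fz (sym (⊕≡0⇒≡ e))
    Bw : B w ≡ true
    Bw = B⊕ z (P z) Bz (closed z Bz)
    sameCoset : ∀ {b b'} → b ∈ ⟨ w , P w ⟩ → b' ∈ ⟨ w , P w ⟩ → IsFixed (b ⊕ b') → b ≡ b'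
    sameCoset b∈ b'∈ F = ⊕≡0⇒≡ (fixed∩W F (W-⊕ (All.lookup (orbit-W Ww) b∈) (All.lookup (orbit-W Ww) b'∈)))
    sums-distinct : Unique (cartesianProductWith _⊕_ ⟨ x , y ⟩ ⟨ w , P w ⟩)
    sums-distinct = coset-sums-unique IsFixed fixed-⊕ ⟨ x , y ⟩ ⟨ w , P w ⟩
      (All-⟨,⟩ IsFixed P-0 Fx Fy fixed-⊕) (⟨,⟩-unique x≢0 y≢0 x≢y) (orbit-unique Ww w≢0) sameCoset
    sums-in-B : All (λ c → B c ≡ true) (cartesianProductWith _⊕_ ⟨ x , y ⟩ ⟨ w , P w ⟩)
    sums-in-B = coset-sums-∈ B B⊕ ⟨ x , y ⟩ ⟨ w , P w ⟩
      (All-⟨,⟩ _ B0 Bx By (λ {a} {b} → B⊕ a b)) (All-⟨,⟩ _ B0 Bw (closed w Bw) (λ {a} {b} → B⊕ a b))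
    16≤8 : 16 ≤ 8
    16≤8 = subst (16 ≤_) (#-subspace 3 B3) (length≤# B _ sums-distinct sums-in-B)

  -- In a P-closed plane B containing w ∈ W ∖ 0, every q ∈ B ∩ W lies
  -- in ⟨ w , P w ⟩: otherwise B consists of the 8 sums of ⟨ w , P w ⟩ and
  -- {0, q}, and writing P q as such a sum forces q ∈ ⟨ w , P w ⟩ after all.
  W∩plane : ∀ {B} → IsSubspace v 3 B → PClosed B → ∀ {w} → InW w → w ≢ 0v → B w ≡ true →
    ∀ {q} → B q ≡ true → InW q → q ∈ ⟨ w , P w ⟩
  W∩plane {B} B3@(B0 , B⊕ , _) closed {w} Ww w≢0 Bw {q} Bq Wq with DecMem._∈?_ _≟v_ q ⟨ w , P w ⟩
  ... | yes q∈ = q∈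
  ... | no q∉ = ⊥-elim (q∉ (P-preimage (#-full B sums sums-distinct sums-in-B (#-subspace 3 B3) (P q) (closed q Bq))))
    where
    U : Vect v → Set
    U = _∈ ⟨ w , P w ⟩
    q≢0 : q ≢ 0v
    q≢0 refl = q∉ (here refl)
    sameCoset : ∀ {b b'} → b ∈ 0v ∷ q ∷ [] → b' ∈ 0v ∷ q ∷ [] → U (b ⊕ b') → b ≡ b'
    sameCoset (here refl) (here refl) _ = refl
    sameCoset (here refl) (there (here refl)) u = ⊥-elim (q∉ (subst U (trans (⊕-comm 0v q) (⊕-identityʳ q)) u))
    sameCoset (there (here refl)) (here refl) u = ⊥-elim (q∉ (subst U (⊕-identityʳ q) u))
    sameCoset (there (here refl)) (there (here refl)) _ = refl
    sums : List (Vect v)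
    sums = cartesianProductWith _⊕_ ⟨ w , P w ⟩ (0v ∷ q ∷ [])
    sums-distinct : Unique sums
    sums-distinct = coset-sums-unique U span-closed ⟨ w , P w ⟩ (0v ∷ q ∷ [])
      (All.tabulate (λ a∈ → a∈)) (orbit-unique Ww w≢0) (((λ e → q≢0 (sym e)) ∷ []) ∷ [] ∷ []) sameCoset
    sums-in-B : All (λ c → B c ≡ true) sums
    sums-in-B = coset-sums-∈ B B⊕ ⟨ w , P w ⟩ (0v ∷ q ∷ [])
      (All-⟨,⟩ _ B0 Bw (closed w Bw) (λ {a} {b} → B⊕ a b)) (B0 ∷ Bq ∷ [])
    P-preimage : P q ∈ sums → q ∈ ⟨ w , P w ⟩
    P-preimage m with MP.∈-cartesianProductWith⁻ _⊕_ ⟨ w , P w ⟩ (0v ∷ q ∷ []) m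
    ... | a , _ , a∈ , here refl , e =
      subst U (cube q) (orbit-P Ww (orbit-P Ww (subst U (sym (trans e (⊕-identityʳ a))) a∈)))
    ... | a , _ , a∈ , there (here refl) , e =
      subst U (sym (W-shift a Wq (trans e (⊕-comm a q)))) (orbit-P Ww a∈)

  orbitPointsIn : VSet v → VSet v
  orbitPointsIn B x = onOrbitLineᵇ M x ∧ (span x (P x) ⊆ᵇ B)

  -- A P-closed plane through w ∈ W ∖ 0 contains the points of exactly one
  -- orbit line, namely w, P w and w ⊕ P w = P² w.
  #orbitPointsIn-plane : ∀ {B} → IsSubspace v 3 B → PClosed B → ∀ {w} → InW w → w ≢ 0v → B w ≡ true →
    # (orbitPointsIn B) ≡ 3
  #orbitPointsIn-plane {B} B3@(B0 , B⊕ , _) closed {w} Ww w≢0 Bw =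
    #-list (orbitPointsIn B) orbit orbit-distinct (λ q → onlyOrbit) (λ q → allOrbit)
    where
    orbit : List (Vect v)
    orbit = w ∷ P w ∷ w ⊕ P w ∷ []
    orbit-distinct : Unique orbit
    orbit-distinct with orbit-unique Ww w≢0
    ... | _ ∷ distinct = distinct
    onlyOrbit : ∀ {q} → orbitPointsIn B q ≡ true → q ∈ orbit
    onlyOrbit {q} h with onOrbitLine-sound q (∧-true-l h)
    ... | q≢0 , Wq with W∩plane B3 closed Ww w≢0 Bw (⊆ᵇ-elim (span q (P q)) B (∧-true-r {onOrbitLineᵇ M q} h) q (span-∋x q (P q))) Wq
    ...   | here q≡0 = ⊥-elim (q≢0 q≡0)
    ...   | there q∈ = q∈
    allOrbit : ∀ {q} → q ∈ orbit → orbitPointsIn B q ≡ true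
    allOrbit {q} q∈ = ∧-true (onOrbitLine-complete q q≢0 Wq) (span⊆ 3 q (P q) B B3 Bq (closed q Bq))
      where
      q∈⟨⟩ : q ∈ ⟨ w , P w ⟩
      q∈⟨⟩ = there q∈
      q≢0 : q ≢ 0v
      q≢0 with orbit-unique Ww w≢0
      ... | 0∉orbit ∷ _ = λ e → All.lookup 0∉orbit q∈ (sym e)
      Wq : InW q
      Wq = All.lookup (orbit-W Ww) q∈⟨⟩
      Bq : B q ≡ true
      Bq = All.lookup (All-⟨,⟩ (λ a → B a ≡ true) B0 Bw (closed w Bw) (λ {a} {b} → B⊕ a b)) q∈⟨⟩

  nonFixedPoint : ∀ B → allPointsFixedᵇ M B ≡ false → Σ (Vect v) (λ z → (B z ≡ true) × (P z ≢ z))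
  nonFixedPoint B h with all-counterexample (λ x → not (B x) ∨ (P x == x)) (allVecs v) h
  ... | z , bad with B z in Bz
  ...   | true = z , Bz , (λ e → bool-contradiction (==-complete e) bad)

  -- P is a bijection of F₂^v, so sums are invariant under substituting P x.
  ΣV-P : ∀ (g : Vect v → ℕ) → ΣV (λ x → g (P x)) ≡ ΣV g
  ΣV-P g = begin
    ΣV (λ x → g (P x))                            ≡⟨ Σ-cong (allVecs v) (λ x → sym (ΣV-point (P x) g)) ⟩
    ΣV (λ x → ΣV (λ y → χ (y == P x) * g y))      ≡⟨ Σ-swap (allVecs v) (allVecs v) _ ⟩
    ΣV (λ y → ΣV (λ x → χ (y == P x) * g y))      ≡⟨ Σ-cong (allVecs v) (λ y → Σ-*ʳ (allVecs v) (λ x → χ (y == P x)) (g y)) ⟩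
    ΣV (λ y → ΣV (λ x → χ (y == P x)) * g y)      ≡⟨ Σ-cong (allVecs v) (λ y → cong (_* g y) (one-preimage y)) ⟩
    ΣV (λ y → 1 * g y)                            ≡⟨ Σ-cong (allVecs v) (λ y → NP.*-identityˡ (g y)) ⟩
    ΣV g                                          ∎
    where
    open ≡-Reasoning
    -- the unique preimage of y is P² y
    one-preimage : ∀ y → ΣV (λ x → χ (y == P x)) ≡ 1
    one-preimage y = trans (Σ-cong (allVecs v) (λ x → cong χ (preimage x))) (#-singleton (P (P y)))
      where
      preimage : ∀ x → (y == P x) ≡ (x == P (P y))
      preimage x = bool-iff (λ h → ==-complete (trans (sym (cube x)) (cong (P ∘ P) (sym (==-sound {x = y} {P x} h)))))
                            (λ h → ==-complete (trans (sym (cube y)) (cong P (sym (==-sound {x = x} {P (P y)} h)))))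

  leastInOrbit : Vect v → Bool
  leastInOrbit x = (val x ≤ᵇ val (P x)) ∧ (val x ≤ᵇ val (P (P x)))

  -- Orbit counting: if S is P-invariant and P has no fixed point in S, each
  -- orbit in S has three points, exactly one of them least, so
  -- |S| = 3 · #{x ∈ S least in its orbit}.
  #-orbits : ∀ (S : VSet v) → (∀ x → S (P x) ≡ S x) → (∀ x → S x ≡ true → P x ≢ x) →
    # S ≡ 3 * # (λ x → S x ∧ leastInOrbit x)
  #-orbits S S-inv S-free = begin
    ΣV (λ x → χ (S x))                                  ≡⟨ Σ-cong (allVecs v) orbit-split ⟩
    ΣV (λ x → rep x + (rep (P x) + rep (P (P x))))      ≡⟨ Σ-+ (allVecs v) _ _ ⟩
    R + ΣV (λ x → rep (P x) + rep (P (P x)))            ≡⟨ cong (R +_) (Σ-+ (allVecs v) _ _) ⟩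
    R + (ΣV (λ x → rep (P x)) + ΣV (λ x → rep (P (P x))))
      ≡⟨ cong (R +_) (cong₂ _+_ (ΣV-P rep) (trans (ΣV-P (rep ∘ P)) (ΣV-P rep))) ⟩
    R + (R + R)                                         ≡⟨ cong (λ t → R + (R + t)) (sym (NP.+-identityʳ R)) ⟩
    3 * R                                               ∎
    where
    open ≡-Reasoning
    rep : Vect v → ℕ
    rep x = χ (S x ∧ leastInOrbit x)
    R : ℕ
    R = ΣV rep
    orbit-split : ∀ x → χ (S x) ≡ rep x + (rep (P x) + rep (P (P x)))
    orbit-split x with S x in Sx
    ... | false rewrite S-inv x | S-inv (P x) | S-inv x | Sx = refl
    ... | true rewrite S-inv x | S-inv (P x) | S-inv x | Sx | cube x = sym (exactlyOneLeast _ _ _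
          (λ e → S-free x Sx (sym (val-injective x (P x) e)))
          (λ e → S-free x Sx (sym (P-injective (val-injective (P x) (P (P x)) e))))
          (λ e → S-free x Sx (trans (cong P (val-injective x (P (P x)) e)) (cube x))))

  onOrbitLine-P : ∀ x → onOrbitLineᵇ M (P x) ≡ onOrbitLineᵇ M x
  onOrbitLine-P x = bool-iff fromP toP
    where
    fromP : onOrbitLineᵇ M (P x) ≡ true → onOrbitLineᵇ M x ≡ true
    fromP h with onOrbitLine-sound (P x) h
    ... | Px≢0 , WPx = onOrbitLine-complete x (λ e → Px≢0 (trans (cong P e) P-0)) (subst InW (cube x) (W-P (W-P WPx)))
    toP : onOrbitLineᵇ M x ≡ true → onOrbitLineᵇ M (P x) ≡ true
    toP h with onOrbitLine-sound x h
    ... | x≢0 , Wx = onOrbitLine-complete (P x) (P≢0 x≢0) (W-P Wx)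

  #onOrbitLine : # (onOrbitLineᵇ M) ≡ 3 * #orbitLines M
  #onOrbitLine = trans (#-orbits (onOrbitLineᵇ M) onOrbitLine-P noFixedPoint)
                       (cong (3 *_) (sym (card≡# (isOrbitRepᵇ M))))
    where
    noFixedPoint : ∀ x → onOrbitLineᵇ M x ≡ true → P x ≢ x
    noFixedPoint x h = W-P≢ (proj₂ (onOrbitLine-sound x h)) (proj₁ (onOrbitLine-sound x h))

  fixedSet : VSet v
  fixedSet x = P x == x

  fixedNZ : VSet v
  fixedNZ = fixedSet ∖ 0v

  Wset : VSet v
  Wset x = (x ⊕ (P x ⊕ P (P x))) == 0v

  #fixedNZ : # fixedNZ ≡ # fixedSet ∸ 1
  #fixedNZ = cong (_∸ 1) (sym (#-∖ fixedSet (==-complete P-0)))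

  #onOrbitLine≡#W∸1 : # (onOrbitLineᵇ M) ≡ # Wset ∸ 1
  #onOrbitLine≡#W∸1 = trans (Σ-cong (allVecs v) (λ x → cong χ (W∖0 x))) (cong (_∸ 1) (sym (#-∖ Wset (==-complete W-0))))
    where
    W∖0 : ∀ x → onOrbitLineᵇ M x ≡ (Wset ∖ 0v) x
    W∖0 x = bool-iff
      (λ h → ∖-intro Wset (==-complete (proj₂ (onOrbitLine-sound x h))) (proj₁ (onOrbitLine-sound x h)))
      (λ h → onOrbitLine-complete x (proj₂ (∖-elim Wset {0v} {x} h)) (==-sound (proj₁ (∖-elim Wset {0v} {x} h))))

-- Double counting flags
-- (line L, block B ⊇ L), each line lying in exactly one block, links the
-- fixed blocks to the fixed points and to the orbit lines.
module InvariantSTS {v : ℕ} (M : Mat v) (cube : ∀ x → ((x · M) · M) · M ≡ x)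
  (D : List (VSet v)) (sts : IsSTS2 v D) (inv : Invariant M D) where

  open OrderThree M cube

  block-plane : ∀ {B} → B ∈ D → IsSubspace v 3 B
  block-plane B∈ = All.lookup (proj₁ sts) B∈

  -- A block through a P-closed line L is fixed: its image is again a block
  -- through L, and L lies in only one block.
  block⊇invariantLine⇒fixed : ∀ {B L} → B ∈ D → IsSubspace v 2 L → (L ⊆ᵇ B) ≡ true → PClosed L → Fixes B
  block⊇invariantLine⇒fixed {B} {L} B∈ L2 L⊆B L-closed y with inv B B∈
  ... | B' , B'∈ , B'≡image = trans (sym (B'≡image y)) (cong (λ C → C y) (sym B≡B'))
    where
    L⊆B' : (L ⊆ᵇ B') ≡ true
    L⊆B' = ⊆ᵇ-intro L B' (λ z Lz → trans (B'≡image z) (trans (image-P² B z)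
      (⊆ᵇ-elim L B L⊆B (P (P z)) (L-closed _ (L-closed _ Lz)))))
    B≡B' : B ≡ B'
    B≡B' = count≡1⇒unique (L ⊆ᵇ_) D B∈ B'∈ L⊆B L⊆B' (proj₂ sts L L2)

  incidences : ∀ c L → (c ≡ true → IsSubspace v 2 L) → Σl D (λ B → χ (c ∧ (L ⊆ᵇ B))) ≡ χ c
  incidences c L line = begin
    Σl D (λ B → χ (c ∧ (L ⊆ᵇ B)))      ≡⟨ Σ-cong D (λ B → χ-∧ c (L ⊆ᵇ B)) ⟩
    Σl D (λ B → χ c * χ (L ⊆ᵇ B))      ≡⟨ Σ-*ˡ D (λ B → χ (L ⊆ᵇ B)) (χ c) ⟩
    χ c * Σl D (λ B → χ (L ⊆ᵇ B))      ≡⟨ cong (χ c *_) (sym (count-Σ (L ⊆ᵇ_) D)) ⟩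
    χ c * countContaining D L          ≡⟨ selected c line ⟩
    χ c                                ∎
    where
    open ≡-Reasoning
    selected : ∀ b → (b ≡ true → IsSubspace v 2 L) → χ b * countContaining D L ≡ χ b
    selected false _ = refl
    selected true L2 = cong (_+ 0) (proj₂ sts L (L2 refl))

  fixedPair : Vect v → Vect v → Bool
  fixedPair x y = fixedNZ x ∧ (fixedNZ ∖ x) y

  fixedPair-sound : ∀ {x y} → fixedPair x y ≡ true →
    (IsFixed x × x ≢ 0v) × (IsFixed y × y ≢ 0v) × (y ≢ x)
  fixedPair-sound {x} {y} h with ∖-elim fixedSet (∧-true-l h) | ∖-elim fixedNZ (∧-true-r {fixedNZ x} h)
  ... | Fx , x≢0 | fixedNZy , y≢x with ∖-elim fixedSet fixedNZy
  ...   | Fy , y≢0 = (==-sound Fx , x≢0) , (==-sound Fy , y≢0) , y≢x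

  fixedPair-line : ∀ {x y} → fixedPair x y ≡ true → IsSubspace v 2 (span x y)
  fixedPair-line h with fixedPair-sound h
  ... | (_ , x≢0) , (_ , y≢0) , y≢x = span-isLine x≢0 y≢0 (λ e → y≢x (sym e))

  fixedPair⇒type7 : ∀ {B x y} → B ∈ D → fixedPair x y ≡ true → (span x y ⊆ᵇ B) ≡ true → isType7ᵇ M B ≡ true
  fixedPair⇒type7 {B} {x} {y} B∈ h span⊆B with fixedPair-sound h
  ... | (Fx , x≢0) , (Fy , y≢0) , y≢x =
    ∧-true (isFixed-complete B B-fixed) (allPointsFixed-complete B
      (fixedPointwise (block-plane B∈) (fixes⇒P-closed B B-fixed) (inSpan (span-∋x x y)) (inSpan (span-∋y x y))
        x≢0 y≢0 (λ e → y≢x (sym e)) Fx Fy))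
    where
    inSpan : ∀ {z} → span x y z ≡ true → B z ≡ true
    inSpan {z} = ⊆ᵇ-elim (span x y) B span⊆B z
    span-closed-P : PClosed (span x y)
    span-closed-P z h' = span-intro x y (fixed-member (span-elim x y {z} h'))
      where
      fixed-member : ∀ {a} → a ∈ ⟨ x , y ⟩ → P a ∈ ⟨ x , y ⟩
      fixed-member a∈ = subst (_∈ ⟨ x , y ⟩) (sym (All.lookup (All-⟨,⟩ IsFixed P-0 Fx Fy fixed-⊕) a∈)) a∈
    B-fixed : Fixes B
    B-fixed = block⊇invariantLine⇒fixed B∈ (fixedPair-line h) span⊆B span-closed-P

  fixedPairsIn : VSet v → ℕ
  fixedPairsIn B = ΣV (λ x → ΣV (λ y → χ (fixedPair x y ∧ (span x y ⊆ᵇ B))))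

  fixedPairsIn-type7 : ∀ {B} → B ∈ D → fixedPairsIn B ≡ 42 * χ (isType7ᵇ M B)
  fixedPairsIn-type7 {B} B∈ with isType7ᵇ M B in type7
  ... | false = Σ-zero (allVecs v) (λ x → Σ-zero (allVecs v) (λ y → cong χ (≢true (λ h →
      bool-contradiction (fixedPair⇒type7 B∈ (∧-true-l h) (∧-true-r {fixedPair x y} h)) type7))))
  ... | true = trans (Σ-cong (allVecs v) (λ x → Σ-cong (allVecs v) (λ y → cong χ (pairInB x y))))
                     (#-pairs B∗ 7 #B∗)
    where
    B3 : IsSubspace v 3 B
    B3 = block-plane B∈
    B∗ : VSet v
    B∗ = B ∖ 0v
    #B∗ : # B∗ ≡ 7
    #B∗ = NP.suc-injective (trans (sym (#-∖ B (proj₁ B3))) (#-subspace 3 B3))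
    B-pointwise : ∀ x → B x ≡ true → IsFixed x
    B-pointwise = allPointsFixed-sound B (∧-true-r {isFixedᵇ M B} type7)
    pairInB : ∀ x y → (fixedPair x y ∧ (span x y ⊆ᵇ B)) ≡ (B∗ x ∧ (B∗ ∖ x) y)
    pairInB x y = bool-iff toB fromB
      where
      toB : (fixedPair x y ∧ (span x y ⊆ᵇ B)) ≡ true → (B∗ x ∧ (B∗ ∖ x) y) ≡ true
      toB h with fixedPair-sound (∧-true-l h)
      ... | (_ , x≢0) , (_ , y≢0) , y≢x =
        ∧-true (∖-intro B (inB (span-∋x x y)) x≢0) (∖-intro B∗ (∖-intro B (inB (span-∋y x y)) y≢0) y≢x)
        where
        inB : ∀ {z} → span x y z ≡ true → B z ≡ true
        inB {z} = ⊆ᵇ-elim (span x y) B (∧-true-r {fixedPair x y} h) z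
      fromB : (B∗ x ∧ (B∗ ∖ x) y) ≡ true → (fixedPair x y ∧ (span x y ⊆ᵇ B)) ≡ true
      fromB h with ∖-elim B (∧-true-l h) | ∖-elim B∗ (∧-true-r {B∗ x} h)
      ... | Bx , x≢0 | B∗y , y≢x with ∖-elim B B∗y
      ...   | By , y≢0 =
        ∧-true (∧-true (fixedNZ-intro Bx x≢0) (∖-intro fixedNZ (fixedNZ-intro By y≢0) y≢x)) (span⊆ 3 x y B B3 Bx By)
        where
        fixedNZ-intro : ∀ {z} → B z ≡ true → z ≢ 0v → fixedNZ z ≡ true
        fixedNZ-intro {z} Bz z≢0 = ∖-intro fixedSet (==-complete (B-pointwise z Bz)) z≢0

  orbitLine : ∀ {x} → onOrbitLineᵇ M x ≡ true → IsSubspace v 2 (span x (P x))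
  orbitLine {x} h with onOrbitLine-sound x h
  ... | x≢0 , Wx = span-isLine x≢0 (P≢0 x≢0) (λ e → W-P≢ Wx x≢0 (sym e))

  orbitLine⇒type1 : ∀ {B x} → B ∈ D → onOrbitLineᵇ M x ≡ true → (span x (P x) ⊆ᵇ B) ≡ true → isType1ᵇ M B ≡ true
  orbitLine⇒type1 {B} {x} B∈ h span⊆B with onOrbitLine-sound x h
  ... | x≢0 , Wx = ∧-true (isFixed-complete B B-fixed) (cong not (≢true notPointwise))
    where
    span-closed-P : PClosed (span x (P x))
    span-closed-P z h' = span-intro x (P x) (orbit-P Wx (span-elim x (P x) {z} h'))
    B-fixed : Fixes B
    B-fixed = block⊇invariantLine⇒fixed B∈ (orbitLine h) span⊆B span-closed-P
    notPointwise : allPointsFixedᵇ M B ≢ true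
    notPointwise pointwise =
      W-P≢ Wx x≢0 (allPointsFixed-sound B pointwise x (⊆ᵇ-elim (span x (P x)) B span⊆B x (span-∋x x (P x))))

  #orbitPointsIn-type1 : ∀ {B} → B ∈ D → # (orbitPointsIn B) ≡ 3 * χ (isType1ᵇ M B)
  #orbitPointsIn-type1 {B} B∈ with isType1ᵇ M B in type1
  ... | false = Σ-zero (allVecs v) (λ x → cong χ (≢true (λ h →
      bool-contradiction (orbitLine⇒type1 B∈ (∧-true-l h) (∧-true-r {onOrbitLineᵇ M x} h)) type1)))
  ... | true with nonFixedPoint B (BP.not-injective (∧-true-r {isFixedᵇ M B} type1))
  -- a non-fixed point z of B gives the point z ⊕ P z of B ∩ W ∖ 0
  ...   | z , Bz , ¬Fz = #orbitPointsIn-plane B3 closed (W-trace z) (λ e → ¬Fz (sym (⊕≡0⇒≡ e)))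
                                             (proj₁ (proj₂ B3) z (P z) Bz (closed z Bz))
    where
    B3 : IsSubspace v 3 B
    B3 = block-plane B∈
    closed : PClosed B
    closed = fixes⇒P-closed B (isFixed-sound B (∧-true-l type1))

  42#F7≡fixedPairs : 42 * #F7 M D ≡ ΣV (λ x → ΣV (λ y → χ (fixedPair x y)))
  42#F7≡fixedPairs = begin
    42 * #F7 M D                                                 ≡⟨ cong (42 *_) (count-Σ (isType7ᵇ M) D) ⟩
    42 * Σl D (λ B → χ (isType7ᵇ M B))                           ≡⟨ Σ-*ˡ D _ 42 ⟨
    Σl D (λ B → 42 * χ (isType7ᵇ M B))                           ≡⟨ Σ-cong∈ D (λ B B∈ → fixedPairsIn-type7 B∈) ⟨
    Σl D fixedPairsIn                                            ≡⟨ Σ-swap D (allVecs v) _ ⟩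
    ΣV (λ x → Σl D (λ B → ΣV (λ y → χ (fixedPair x y ∧ (span x y ⊆ᵇ B)))))
                                                                 ≡⟨ Σ-cong (allVecs v) (λ x → Σ-swap D (allVecs v) _) ⟩
    ΣV (λ x → ΣV (λ y → Σl D (λ B → χ (fixedPair x y ∧ (span x y ⊆ᵇ B)))))
                                                                 ≡⟨ Σ-cong (allVecs v) (λ x → Σ-cong (allVecs v) (λ y →
                                                                      incidences (fixedPair x y) (span x y) fixedPair-line)) ⟩
    ΣV (λ x → ΣV (λ y → χ (fixedPair x y)))                      ∎
    where open ≡-Reasoning

  3#F1≡orbitPoints : 3 * #F1 M D ≡ # (onOrbitLineᵇ M)
  3#F1≡orbitPoints = begin
    3 * #F1 M D                                    ≡⟨ cong (3 *_) (count-Σ (isType1ᵇ M) D) ⟩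
    3 * Σl D (λ B → χ (isType1ᵇ M B))              ≡⟨ Σ-*ˡ D _ 3 ⟨
    Σl D (λ B → 3 * χ (isType1ᵇ M B))              ≡⟨ Σ-cong∈ D (λ B B∈ → #orbitPointsIn-type1 B∈) ⟨
    Σl D (λ B → # (orbitPointsIn B))               ≡⟨ Σ-swap D (allVecs v) _ ⟩
    ΣV (λ x → Σl D (λ B → χ (orbitPointsIn B x)))  ≡⟨ Σ-cong (allVecs v) (λ x → incidences (onOrbitLineᵇ M x) (span x (P x)) orbitLine) ⟩
    # (onOrbitLineᵇ M)                                   ∎
    where open ≡-Reasoning

zeroPrefix : ∀ {v} → ℕ → Vect v → Bool
zeroPrefix zero x = true
zeroPrefix (suc k) [] = true
zeroPrefix (suc k) (b ∷ x) = not b ∧ zeroPrefix k x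

zeroSuffix : ∀ {v} → ℕ → Vect v → Bool
zeroSuffix k [] = true
zeroSuffix zero (b ∷ x) = not b ∧ zeroSuffix zero x
zeroSuffix (suc k) (b ∷ x) = zeroSuffix k x

not-true : ∀ {b} → not b ≡ true → b ≡ false
not-true {false} _ = refl

zeroPrefix-sound : ∀ {v} k (x : Vect v) → zeroPrefix k x ≡ true → ∀ j → toℕ j < k → lookup x j ≡ false
zeroPrefix-sound (suc k) (b ∷ x) h F.zero _ = not-true (∧-true-l h)
zeroPrefix-sound (suc k) (b ∷ x) h (F.suc j) (s≤s j<k) = zeroPrefix-sound k x (∧-true-r {not b} h) j j<k

zeroPrefix-complete : ∀ {v} k (x : Vect v) → (∀ j → toℕ j < k → lookup x j ≡ false) → zeroPrefix k x ≡ true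
zeroPrefix-complete zero x h = refl
zeroPrefix-complete (suc k) [] h = refl
zeroPrefix-complete (suc k) (b ∷ x) h rewrite h F.zero (s≤s z≤n) = zeroPrefix-complete k x (λ j j<k → h (F.suc j) (s≤s j<k))

zeroSuffix-sound : ∀ {v} k (x : Vect v) → zeroSuffix k x ≡ true → ∀ j → k ≤ toℕ j → lookup x j ≡ false
zeroSuffix-sound zero (b ∷ x) h F.zero _ = not-true (∧-true-l h)
zeroSuffix-sound zero (b ∷ x) h (F.suc j) _ = zeroSuffix-sound zero x (∧-true-r {not b} h) j z≤n
zeroSuffix-sound (suc k) (b ∷ x) h (F.suc j) (s≤s k≤j) = zeroSuffix-sound k x h j k≤j

zeroSuffix-complete : ∀ {v} k (x : Vect v) → (∀ j → k ≤ toℕ j → lookup x j ≡ false) → zeroSuffix k x ≡ true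
zeroSuffix-complete k [] h = refl
zeroSuffix-complete zero (b ∷ x) h rewrite h F.zero z≤n = zeroSuffix-complete zero x (λ j _ → h (F.suc j) z≤n)
zeroSuffix-complete (suc k) (b ∷ x) h = zeroSuffix-complete k x (λ j k≤j → h (F.suc j) (s≤s k≤j))

#-all : ∀ {v} → ΣV {v} (λ _ → 1) ≡ 2 ^ v
#-all {zero} = refl
#-all {suc v} = trans (ΣV-split {v} (λ _ → 1)) (trans (cong₂ _+_ (#-all {v}) (#-all {v})) (double (2 ^ v)))
  where
  double : ∀ a → a + a ≡ 2 * a
  double a = cong (a +_) (sym (NP.+-identityʳ a))

#zeroPrefix : ∀ {v} k → k ≤ v → # (zeroPrefix {v} k) ≡ 2 ^ (v ∸ k)
#zeroPrefix {v} zero _ = #-all {v}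
#zeroPrefix {suc v} (suc k) (s≤s k≤v) = trans (ΣV-split {v} (λ x → χ (zeroPrefix (suc k) x)))
  (trans (cong₂ _+_ (#zeroPrefix {v} k k≤v) (Σ-zero (allVecs v) (λ _ → refl))) (NP.+-identityʳ _))

#zeroSuffix : ∀ {v} k → k ≤ v → # (zeroSuffix {v} k) ≡ 2 ^ k
#zeroSuffix {zero} zero _ = refl
#zeroSuffix {suc v} zero _ = trans (ΣV-split {v} (λ x → χ (zeroSuffix zero x)))
  (cong₂ _+_ (#zeroSuffix {v} zero z≤n) (Σ-zero (allVecs v) (λ _ → refl)))
#zeroSuffix {suc v} (suc k) (s≤s k≤v) = trans (ΣV-split {v} (λ x → χ (zeroSuffix (suc k) x)))
  (trans (cong₂ _+_ (#zeroSuffix {v} k k≤v) (#zeroSuffix {v} k k≤v)) (cong (2 ^ k +_) (sym (NP.+-identityʳ (2 ^ k)))))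

half-even : ∀ c → c * 2 / 2 ≡ c
half-even c = m*n/n≡m c 2

half-odd : ∀ c → suc (c * 2) / 2 ≡ c
half-odd zero = refl
half-odd (suc c) = trans (m/n≡1+[m∸n]/n {suc (suc (suc (c * 2)))} {2} (s≤s (s≤s z≤n))) (cong suc (half-odd c))

parity-even : ∀ c → c * 2 % 2 ≡ 0
parity-even c = m*n%n≡0 c 2

parity-odd : ∀ c → suc (c * 2) % 2 ≡ 1
parity-odd c = [m+kn]%n≡m%n 1 c 2

even-or-odd : ∀ a → (a ≡ (a / 2) * 2) ⊎ (a ≡ suc ((a / 2) * 2))
even-or-odd a with a % 2 | m%n<n a 2 | m≡m%n+[m/n]*n a 2
... | zero | _ | e = inj₁ e
... | suc zero | _ | e = inj₂ e
... | suc (suc _) | s≤s (s≤s ()) | _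

≡ᵇ-refl : ∀ b → (b ≡ᵇ b) ≡ true
≡ᵇ-refl zero = refl
≡ᵇ-refl (suc b) = ≡ᵇ-refl b

≢⇒≡ᵇfalse : ∀ {a b} → a ≢ b → (a ≡ᵇ b) ≡ false
≢⇒≡ᵇfalse {a} {b} a≢b = ≢true (λ e → a≢b (NP.≡ᵇ⇒≡ a b (subst T (sym e) _)))

blockEntry : ℕ → ℕ → Bool
blockEntry a b = ((a / 2) ≡ᵇ (b / 2)) ∧ not (((a % 2) ≡ᵇ 0) ∧ ((b % 2) ≡ᵇ 0))

blockEntry-ee : ∀ c → blockEntry (c * 2) (c * 2) ≡ false
blockEntry-ee c rewrite half-even c | parity-even c = BP.∧-zeroʳ (c ≡ᵇ c)

blockEntry-oe : ∀ c → blockEntry (suc (c * 2)) (c * 2) ≡ true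
blockEntry-oe c rewrite half-even c | parity-even c | half-odd c | parity-odd c = trans (BP.∧-identityʳ (c ≡ᵇ c)) (≡ᵇ-refl c)

blockEntry-eo : ∀ c → blockEntry (c * 2) (suc (c * 2)) ≡ true
blockEntry-eo c rewrite half-even c | parity-even c | half-odd c | parity-odd c = trans (BP.∧-identityʳ (c ≡ᵇ c)) (≡ᵇ-refl c)

blockEntry-oo : ∀ c → blockEntry (suc (c * 2)) (suc (c * 2)) ≡ true
blockEntry-oo c rewrite half-odd c | parity-odd c = trans (BP.∧-identityʳ (c ≡ᵇ c)) (≡ᵇ-refl c)

-- Writing P x = x A, P fixes the last f
-- coordinates and maps each coordinate pair (x_{2c}, x_{2c+1}) of the first
-- v - f coordinates to (x_{2c+1}, x_{2c} + x_{2c+1}).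
module BlockMatrix (v f n : ℕ) (v∸f≡2n : v ∸ f ≡ n * 2) where

  m : ℕ
  m = v ∸ f

  P : Vect v → Vect v
  P x = x · A v f

  <m⇒<ᵇ : ∀ {a} → a < m → (a <ᵇ m) ≡ true
  <m⇒<ᵇ a<m = T⇒≡true (NP.<⇒<ᵇ a<m)

  ≥m⇒<ᵇ : ∀ {a} → m ≤ a → (a <ᵇ m) ≡ false
  ≥m⇒<ᵇ {a} m≤a = ≢true (λ e → NP.<⇒≱ (NP.<ᵇ⇒< a m (subst T (sym e) _)) m≤a)

  ≥m⇒≤ᵇ : ∀ {a} → m ≤ a → (m ≤ᵇ a) ≡ true
  ≥m⇒≤ᵇ m≤a = T⇒≡true (NP.≤⇒≤ᵇ m≤a)

  <m⇒≤ᵇ : ∀ {a} → a < m → (m ≤ᵇ a) ≡ false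
  <m⇒≤ᵇ {a} a<m = ≢true (λ e → NP.<⇒≱ a<m (NP.≤ᵇ⇒≤ m a (subst T (sym e) _)))

  A-diag : ∀ j → m ≤ toℕ j → A v f j j ≡ true
  A-diag j m≤j rewrite ≥m⇒<ᵇ m≤j | ≥m⇒≤ᵇ m≤j = ≡ᵇ-refl (toℕ j)

  A-identityPart : ∀ i j → m ≤ toℕ j → i ≢ j → A v f i j ≡ false
  A-identityPart i j m≤j i≢j with toℕ i NP.<? m
  ... | yes i<m rewrite <m⇒<ᵇ i<m | ≥m⇒<ᵇ m≤j | <m⇒≤ᵇ i<m = refl
  ... | no i≮m rewrite ≥m⇒<ᵇ (NP.≮⇒≥ i≮m) | ≥m⇒≤ᵇ (NP.≮⇒≥ i≮m) | ≥m⇒≤ᵇ m≤j =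
    ≢⇒≡ᵇfalse (λ e → i≢j (FP.toℕ-injective e))

  A-offBlocks : ∀ i j → toℕ j < m → m ≤ toℕ i → A v f i j ≡ false
  A-offBlocks i j j<m m≤i rewrite ≥m⇒<ᵇ m≤i | ≥m⇒≤ᵇ m≤i | <m⇒≤ᵇ j<m = refl

  A-blocks : ∀ i j → toℕ i < m → toℕ j < m → A v f i j ≡ blockEntry (toℕ i) (toℕ j)
  A-blocks i j i<m j<m rewrite <m⇒<ᵇ i<m | <m⇒<ᵇ j<m = refl

  odd<m : ∀ c → c < n → suc (c * 2) < m
  odd<m c c<n = subst (suc (c * 2) <_) (sym v∸f≡2n) (NP.*-monoˡ-≤ 2 c<n)

  even<m : ∀ c → c < n → c * 2 < m
  even<m c c<n = NP.<-trans (NP.n<1+n (c * 2)) (odd<m c c<n)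

  <m⇒<v : ∀ {a} → a < m → a < v
  <m⇒<v a<m = NP.<-≤-trans a<m (NP.m∸n≤m v f)

  evenIx oddIx : ∀ c → c < n → Fin v
  evenIx c c<n = F.fromℕ< (<m⇒<v (even<m c c<n))
  oddIx c c<n = F.fromℕ< (<m⇒<v (odd<m c c<n))

  toℕ-evenIx : ∀ c c<n → toℕ (evenIx c c<n) ≡ c * 2
  toℕ-evenIx c c<n = FP.toℕ-fromℕ< (<m⇒<v (even<m c c<n))

  toℕ-oddIx : ∀ c c<n → toℕ (oddIx c c<n) ≡ suc (c * 2)
  toℕ-oddIx c c<n = FP.toℕ-fromℕ< (<m⇒<v (odd<m c c<n))

  evenIx≢oddIx : ∀ c c<n → evenIx c c<n ≢ oddIx c c<n
  evenIx≢oddIx c c<n e = NP.1+n≢n (sym (trans (sym (toℕ-evenIx c c<n)) (trans (cong toℕ e) (toℕ-oddIx c c<n))))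

  evenIx<m : ∀ c c<n → toℕ (evenIx c c<n) < m
  evenIx<m c c<n = subst (_< m) (sym (toℕ-evenIx c c<n)) (even<m c c<n)

  oddIx<m : ∀ c c<n → toℕ (oddIx c c<n) < m
  oddIx<m c c<n = subst (_< m) (sym (toℕ-oddIx c c<n)) (odd<m c c<n)

  data Coordinate (j : Fin v) : Set where
    fixedPart : m ≤ toℕ j → Coordinate j
    evenPart : ∀ c c<n → j ≡ evenIx c c<n → Coordinate j
    oddPart : ∀ c c<n → j ≡ oddIx c c<n → Coordinate j

  block<n : ∀ {a} → a < m → a / 2 < n
  block<n {a} a<m = m<n*o⇒m/o<n (subst (a <_) v∸f≡2n a<m)

  coordinate : ∀ j → Coordinate j
  coordinate j with toℕ j NP.<? m
  ... | no j≮m = fixedPart (NP.≮⇒≥ j≮m)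
  ... | yes j<m with even-or-odd (toℕ j)
  ...   | inj₁ e = evenPart (toℕ j / 2) (block<n j<m) (FP.toℕ-injective (trans e (sym (toℕ-evenIx _ (block<n j<m)))))
  ...   | inj₂ e = oddPart (toℕ j / 2) (block<n j<m) (FP.toℕ-injective (trans e (sym (toℕ-oddIx _ (block<n j<m)))))

  A-blockColumn : ∀ i j c c<n → toℕ j < m → toℕ j / 2 ≡ c → i ≢ evenIx c c<n → i ≢ oddIx c c<n → A v f i j ≡ false
  A-blockColumn i j c c<n j<m j∈c i≢even i≢odd with toℕ i NP.<? m
  ... | no i≮m = A-offBlocks i j j<m (NP.≮⇒≥ i≮m)
  ... | yes i<m with (toℕ i / 2) NP.≟ c
  ...   | no i∉c = trans (A-blocks i j i<m j<m)
          (cong (_∧ not (((toℕ i % 2) ≡ᵇ 0) ∧ ((toℕ j % 2) ≡ᵇ 0))) (trans (cong ((toℕ i / 2) ≡ᵇ_) j∈c) (≢⇒≡ᵇfalse i∉c)))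
  ...   | yes i∈c with even-or-odd (toℕ i)
  ...     | inj₁ e = ⊥-elim (i≢even (FP.toℕ-injective (trans e (trans (cong (_* 2) i∈c) (sym (toℕ-evenIx c c<n))))))
  ...     | inj₂ e = ⊥-elim (i≢odd (FP.toℕ-injective (trans e (trans (cong (λ t → suc (t * 2)) i∈c) (sym (toℕ-oddIx c c<n))))))

  A-ee : ∀ c c<n → A v f (evenIx c c<n) (evenIx c c<n) ≡ false
  A-ee c c<n = trans (A-blocks _ _ (evenIx<m c c<n) (evenIx<m c c<n)) (trans (cong₂ blockEntry (toℕ-evenIx c c<n) (toℕ-evenIx c c<n)) (blockEntry-ee c))

  A-oe : ∀ c c<n → A v f (oddIx c c<n) (evenIx c c<n) ≡ true
  A-oe c c<n = trans (A-blocks _ _ (oddIx<m c c<n) (evenIx<m c c<n)) (trans (cong₂ blockEntry (toℕ-oddIx c c<n) (toℕ-evenIx c c<n)) (blockEntry-oe c))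

  A-eo : ∀ c c<n → A v f (evenIx c c<n) (oddIx c c<n) ≡ true
  A-eo c c<n = trans (A-blocks _ _ (evenIx<m c c<n) (oddIx<m c c<n)) (trans (cong₂ blockEntry (toℕ-evenIx c c<n) (toℕ-oddIx c c<n)) (blockEntry-eo c))

  A-oo : ∀ c c<n → A v f (oddIx c c<n) (oddIx c c<n) ≡ true
  A-oo c c<n = trans (A-blocks _ _ (oddIx<m c c<n) (oddIx<m c c<n)) (trans (cong₂ blockEntry (toℕ-oddIx c c<n) (toℕ-oddIx c c<n)) (blockEntry-oo c))

  P-fixedCoord : ∀ x j → m ≤ toℕ j → lookup (P x) j ≡ lookup x j
  P-fixedCoord x j m≤j = begin
    lookup (P x) j                         ≡⟨ lookup-· x (A v f) j ⟩
    ⨁ (λ i → lookup x i ∧ A v f i j)       ≡⟨ ⨁-single _ j (λ i i≢j → trans (cong (lookup x i ∧_) (A-identityPart i j m≤j i≢j)) (BP.∧-zeroʳ _)) ⟩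
    lookup x j ∧ A v f j j                 ≡⟨ cong (lookup x j ∧_) (A-diag j m≤j) ⟩
    lookup x j ∧ true                      ≡⟨ BP.∧-identityʳ _ ⟩
    lookup x j                             ∎
    where open ≡-Reasoning

  P-evenCoord : ∀ x c c<n → lookup (P x) (evenIx c c<n) ≡ lookup x (oddIx c c<n)
  P-evenCoord x c c<n = begin
    lookup (P x) e                         ≡⟨ lookup-· x (A v f) e ⟩
    ⨁ (λ i → lookup x i ∧ A v f i e)       ≡⟨ ⨁-single _ o vanish ⟩
    lookup x o ∧ A v f o e                 ≡⟨ cong (lookup x o ∧_) (A-oe c c<n) ⟩
    lookup x o ∧ true                      ≡⟨ BP.∧-identityʳ _ ⟩
    lookup x o                             ∎
    where
    open ≡-Reasoning
    e o : Fin v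
    e = evenIx c c<n
    o = oddIx c c<n
    vanish : ∀ i → i ≢ o → (lookup x i ∧ A v f i e) ≡ false
    vanish i i≢o with i F.≟ e
    ... | yes refl = trans (cong (lookup x i ∧_) (A-ee c c<n)) (BP.∧-zeroʳ _)
    ... | no i≢e = trans (cong (lookup x i ∧_) (A-blockColumn i e c c<n (evenIx<m c c<n)
                     (trans (cong (_/ 2) (toℕ-evenIx c c<n)) (half-even c)) i≢e i≢o)) (BP.∧-zeroʳ _)

  P-oddCoord : ∀ x c c<n → lookup (P x) (oddIx c c<n) ≡ lookup x (evenIx c c<n) xor lookup x (oddIx c c<n)
  P-oddCoord x c c<n = begin
    lookup (P x) o                                     ≡⟨ lookup-· x (A v f) o ⟩
    ⨁ (λ i → lookup x i ∧ A v f i o)                   ≡⟨ ⨁-pair _ e o (evenIx≢oddIx c c<n) vanish ⟩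
    (lookup x e ∧ A v f e o) xor (lookup x o ∧ A v f o o)
      ≡⟨ cong₂ (λ s t → (lookup x e ∧ s) xor (lookup x o ∧ t)) (A-eo c c<n) (A-oo c c<n) ⟩
    (lookup x e ∧ true) xor (lookup x o ∧ true)        ≡⟨ cong₂ _xor_ (BP.∧-identityʳ (lookup x e)) (BP.∧-identityʳ (lookup x o)) ⟩
    lookup x e xor lookup x o                          ∎
    where
    open ≡-Reasoning
    e o : Fin v
    e = evenIx c c<n
    o = oddIx c c<n
    vanish : ∀ i → i ≢ e → i ≢ o → (lookup x i ∧ A v f i o) ≡ false
    vanish i i≢e i≢o = trans (cong (lookup x i ∧_) (A-blockColumn i o c c<n (oddIx<m c c<n)
                         (trans (cong (_/ 2) (toℕ-oddIx c c<n)) (half-odd c)) i≢e i≢o)) (BP.∧-zeroʳ _)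

  xor-cancelˡ : ∀ a b → b xor (a xor b) ≡ a
  xor-cancelˡ true true = refl
  xor-cancelˡ true false = refl
  xor-cancelˡ false true = refl
  xor-cancelˡ false false = refl

  xor-cancelʳ : ∀ a b → (a xor b) xor a ≡ b
  xor-cancelʳ true true = refl
  xor-cancelʳ true false = refl
  xor-cancelʳ false true = refl
  xor-cancelʳ false false = refl

  -- A³ = I: the block map has order 3 and the identity part is fixed.
  cube : ∀ x → P (P (P x)) ≡ x
  cube x = vext coord
    where
    a b : ∀ c → c < n → Bool
    a c c<n = lookup x (evenIx c c<n)
    b c c<n = lookup x (oddIx c c<n)
    coord : ∀ j → lookup (P (P (P x))) j ≡ lookup x j
    coord j with coordinate j
    ... | fixedPart m≤j = trans (P-fixedCoord (P (P x)) j m≤j) (trans (P-fixedCoord (P x) j m≤j) (P-fixedCoord x j m≤j))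
    ... | evenPart c c<n refl = begin
      lookup (P (P (P x))) (evenIx c c<n)                                  ≡⟨ P-evenCoord (P (P x)) c c<n ⟩
      lookup (P (P x)) (oddIx c c<n)                                       ≡⟨ P-oddCoord (P x) c c<n ⟩
      lookup (P x) (evenIx c c<n) xor lookup (P x) (oddIx c c<n)           ≡⟨ cong₂ _xor_ (P-evenCoord x c c<n) (P-oddCoord x c c<n) ⟩
      b c c<n xor (a c c<n xor b c c<n)                                    ≡⟨ xor-cancelˡ (a c c<n) (b c c<n) ⟩
      a c c<n                                                              ∎
      where open ≡-Reasoning
    ... | oddPart c c<n refl = begin
      lookup (P (P (P x))) (oddIx c c<n)                                   ≡⟨ P-oddCoord (P (P x)) c c<n ⟩
      lookup (P (P x)) (evenIx c c<n) xor lookup (P (P x)) (oddIx c c<n)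
        ≡⟨ cong₂ _xor_ (P-evenCoord (P x) c c<n) (P-oddCoord (P x) c c<n) ⟩
      lookup (P x) (oddIx c c<n) xor (lookup (P x) (evenIx c c<n) xor lookup (P x) (oddIx c c<n))
        ≡⟨ cong₂ (λ s t → s xor (t xor s)) (P-oddCoord x c c<n) (P-evenCoord x c c<n) ⟩
      (a c c<n xor b c c<n) xor (b c c<n xor (a c c<n xor b c c<n))       ≡⟨ cong ((a c c<n xor b c c<n) xor_) (xor-cancelˡ (a c c<n) (b c c<n)) ⟩
      (a c c<n xor b c c<n) xor a c c<n                                    ≡⟨ xor-cancelʳ (a c c<n) (b c c<n) ⟩
      b c c<n                                                              ∎
      where open ≡-Reasoning

  xor≡right⇒false : ∀ {a b} → a xor b ≡ b → a ≡ false
  xor≡right⇒false {true} {true} ()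
  xor≡right⇒false {true} {false} ()
  xor≡right⇒false {false} _ = refl

  fixed⇔zeroPrefix : ∀ x → (P x == x) ≡ zeroPrefix m x
  fixed⇔zeroPrefix x = bool-iff (λ h → zeroPrefix-complete m x (prefixZero (==-sound h))) (λ h → ==-complete (fixed (zeroPrefix-sound m x h)))
    where
    prefixZero : P x ≡ x → ∀ j → toℕ j < m → lookup x j ≡ false
    prefixZero Px≡x j j<m with coordinate j
    ... | fixedPart m≤j = ⊥-elim (NP.<⇒≱ j<m m≤j)
    ... | evenPart c c<n refl = xor≡right⇒false evenZero
      where
      evenZero : lookup x (evenIx c c<n) xor lookup x (oddIx c c<n) ≡ lookup x (oddIx c c<n)
      evenZero = trans (sym (P-oddCoord x c c<n)) (cong (λ t → lookup t (oddIx c c<n)) Px≡x)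
    ... | oddPart c c<n refl = trans (sym (P-evenCoord x c c<n)) (trans (cong (λ t → lookup t (evenIx c c<n)) Px≡x) (xor≡right⇒false evenZero))
      where
      evenZero : lookup x (evenIx c c<n) xor lookup x (oddIx c c<n) ≡ lookup x (oddIx c c<n)
      evenZero = trans (sym (P-oddCoord x c c<n)) (cong (λ t → lookup t (oddIx c c<n)) Px≡x)
    fixed : (∀ j → toℕ j < m → lookup x j ≡ false) → P x ≡ x
    fixed zero<m = vext coord
      where
      coord : ∀ j → lookup (P x) j ≡ lookup x j
      coord j with coordinate j
      ... | fixedPart m≤j = P-fixedCoord x j m≤j
      ... | evenPart c c<n refl = trans (P-evenCoord x c c<n) (trans (zero<m _ (oddIx<m c c<n)) (sym (zero<m _ (evenIx<m c c<n))))
      ... | oddPart c c<n refl = trans (P-oddCoord x c c<n)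
          (trans (cong₂ _xor_ (zero<m _ (evenIx<m c c<n)) (zero<m _ (oddIx<m c c<n))) (sym (zero<m _ (oddIx<m c c<n))))

  traceVec : Vect v → Vect v
  traceVec x = x ⊕ (P x ⊕ P (P x))

  lookup-traceVec : ∀ x j → lookup (traceVec x) j ≡ lookup x j xor (lookup (P x) j xor lookup (P (P x)) j)
  lookup-traceVec x j = trans (lookup-⊕ x _ j) (cong (lookup x j xor_) (lookup-⊕ (P x) (P (P x)) j))

  -- On each coordinate pair, 1 + T + T² = 0 for T (a, b) = (b, a + b).
  blockTrace-even : ∀ a b → a xor (b xor (a xor b)) ≡ false
  blockTrace-even true true = refl
  blockTrace-even true false = refl
  blockTrace-even false true = refl
  blockTrace-even false false = refl

  blockTrace-odd : ∀ a b → b xor ((a xor b) xor (b xor (a xor b))) ≡ false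
  blockTrace-odd true true = refl
  blockTrace-odd true false = refl
  blockTrace-odd false true = refl
  blockTrace-odd false false = refl

  triple : ∀ a → a xor (a xor a) ≡ a
  triple true = refl
  triple false = refl

  W⇔zeroSuffix : ∀ x → (traceVec x == zeroV v) ≡ zeroSuffix m x
  W⇔zeroSuffix x = bool-iff (λ h → zeroSuffix-complete m x (suffixZero (==-sound h))) (λ h → ==-complete (inW (zeroSuffix-sound m x h)))
    where
    traceFixedCoord : ∀ j → m ≤ toℕ j → lookup (traceVec x) j ≡ lookup x j
    traceFixedCoord j m≤j = trans (lookup-traceVec x j)
      (trans (cong (lookup x j xor_) (cong₂ _xor_ (P-fixedCoord x j m≤j) (trans (P-fixedCoord (P x) j m≤j) (P-fixedCoord x j m≤j))))
             (triple (lookup x j)))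
    suffixZero : traceVec x ≡ zeroV v → ∀ j → m ≤ toℕ j → lookup x j ≡ false
    suffixZero W j m≤j = trans (sym (traceFixedCoord j m≤j)) (trans (cong (λ t → lookup t j) W) (lookup-0 {v} j))
    inW : (∀ j → m ≤ toℕ j → lookup x j ≡ false) → traceVec x ≡ zeroV v
    inW zero≥m = vext coord
      where
      a b : ∀ c → c < n → Bool
      a c c<n = lookup x (evenIx c c<n)
      b c c<n = lookup x (oddIx c c<n)
      coord : ∀ j → lookup (traceVec x) j ≡ lookup (zeroV v) j
      coord j with coordinate j
      ... | fixedPart m≤j = trans (traceFixedCoord j m≤j) (trans (zero≥m j m≤j) (sym (lookup-0 {v} j)))
      ... | evenPart c c<n refl = trans (lookup-traceVec x _)
          (trans (cong (a c c<n xor_) (cong₂ _xor_ (P-evenCoord x c c<n) (trans (P-evenCoord (P x) c c<n) (P-oddCoord x c c<n))))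
          (trans (blockTrace-even (a c c<n) (b c c<n)) (sym (lookup-0 {v} _))))
      ... | oddPart c c<n refl = trans (lookup-traceVec x _)
          (trans (cong (b c c<n xor_) (cong₂ _xor_ (P-oddCoord x c c<n)
                   (trans (P-oddCoord (P x) c c<n) (cong₂ _xor_ (P-evenCoord x c c<n) (P-oddCoord x c c<n)))))
          (trans (blockTrace-odd (a c c<n) (b c c<n)) (sym (lookup-0 {v} _))))

  #fixed : f ≤ v → # (λ x → P x == x) ≡ 2 ^ f
  #fixed f≤v = trans (Σ-cong (allVecs v) (λ x → cong χ (fixed⇔zeroPrefix x)))
    (trans (#zeroPrefix m (NP.m∸n≤m v f)) (cong (2 ^_) (NP.m∸[m∸n]≡n f≤v)))

  #W : # (λ x → traceVec x == zeroV v) ≡ 2 ^ m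
  #W = trans (Σ-cong (allVecs v) (λ x → cong χ (W⇔zeroSuffix x))) (#zeroSuffix m (NP.m∸n≤m v f))

2^f∸2 : ∀ f → (2 ^ f ∸ 1) ∸ 1 ≡ 2 * (2 ^ (f ∸ 1) ∸ 1)
2^f∸2 zero = refl
2^f∸2 (suc g) = trans (NP.∸-+-assoc (2 * 2 ^ g) 1 1) (sym (NP.*-distribˡ-∸ 2 (2 ^ g) 1))

halve-pairCount : ∀ f F → 42 * F ≡ (2 ^ f ∸ 1) * ((2 ^ f ∸ 1) ∸ 1) → 21 * F ≡ (2 ^ f ∸ 1) * (2 ^ (f ∸ 1) ∸ 1)
halve-pairCount f F h = NP.*-cancelˡ-≡ (21 * F) (N * K) 2 (begin
  2 * (21 * F)   ≡⟨ NP.*-assoc 2 21 F ⟨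
  42 * F         ≡⟨ h ⟩
  N * (N ∸ 1)    ≡⟨ cong (N *_) (2^f∸2 f) ⟩
  N * (2 * K)    ≡⟨ NP.*-assoc N 2 K ⟨
  (N * 2) * K    ≡⟨ cong (_* K) (NP.*-comm N 2) ⟩
  (2 * N) * K    ≡⟨ NP.*-assoc 2 N K ⟩
  2 * (N * K)    ∎)
  where
  open ≡-Reasoning
  N K : ℕ
  N = 2 ^ f ∸ 1
  K = 2 ^ (f ∸ 1) ∸ 1

lemma7 : (v f : ℕ) → f < v → 2 ∣ (v ∸ f) →
    (D : List (VSet v)) → IsSTS2 v D → Invariant (A v f) D →
    (21 * #F7 (A v f) D ≡ (2 ^ f ∸ 1) * (2 ^ (f ∸ 1) ∸ 1)) ×
    (#F1 (A v f) D ≡ #orbitLines (A v f)) ×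
    (3 * #orbitLines (A v f) ≡ 2 ^ (v ∸ f) ∸ 1)
lemma7 v f f<v (divides n v∸f≡2n) D sts inv = #F7-formula , #F1≡#orbitLines , #orbitLines-formula
  where
  open BlockMatrix v f n v∸f≡2n using (cube; #fixed; #W)
  open OrderThree (A v f) cube using (fixedNZ; #fixedNZ; #onOrbitLine; #onOrbitLine≡#W∸1)
  open InvariantSTS (A v f) cube D sts inv using (42#F7≡fixedPairs; 3#F1≡orbitPoints)

  #orbitPoints : # (onOrbitLineᵇ (A v f)) ≡ 2 ^ (v ∸ f) ∸ 1
  #orbitPoints = trans #onOrbitLine≡#W∸1 (cong (_∸ 1) #W)

  #F7-formula : 21 * #F7 (A v f) D ≡ (2 ^ f ∸ 1) * (2 ^ (f ∸ 1) ∸ 1)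
  #F7-formula = halve-pairCount f (#F7 (A v f) D)
    (trans 42#F7≡fixedPairs (#-pairs fixedNZ (2 ^ f ∸ 1) (trans #fixedNZ (cong (_∸ 1) (#fixed (NP.<⇒≤ f<v))))))

  #orbitLines-formula : 3 * #orbitLines (A v f) ≡ 2 ^ (v ∸ f) ∸ 1
  #orbitLines-formula = trans (sym #onOrbitLine) #orbitPoints

  #F1≡#orbitLines : #F1 (A v f) D ≡ #orbitLines (A v f)
  #F1≡#orbitLines = NP.*-cancelˡ-≡ (#F1 (A v f) D) (#orbitLines (A v f)) 3 (trans 3#F1≡orbitPoints #onOrbitLine)
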